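{- Let $\vec d=(d_1,\dots,d_q)\in\mathbb N^q$ and $N=d_1\cdots d_q$, and let $\mathrm{orb}(\vec d)$ denote the number of orbits of the action of $(\mathbb Z/N\mathbb Z)^\times$ on $J_{d_1}\times\cdots\times J_{d_q}$. Then \[ \mathrm{orb}(\vec d)=\frac{\prod_{i=1}^q\tilde\varphi(d_i)}{\tilde\varphi(\mathrm{lcm}(d_1,\dots,d_q))}\times 2^{\tilde\beta_0(\Gamma(V_{\vec d}))}. \]
   Context: For $d\in\mathbb N$, $J_1=J_2=\{1\}$ and $J_d=\{j\in\mathbb N:j<d/2,\ \gcd(j,d)=1\}$ for $d\ge3$; for $d\ge3$, $J_d$ is regarded as a set of representatives of $(\mathbb Z/d\mathbb Z)^\times$ modulo the identification $k\sim -k$. $\tilde\varphi(d)=\varphi(d)/2$ for $d\ge3$ and $\tilde\varphi(1)=\tilde\varphi(2)=1$, where $\varphi$ is Euler's function (so $|J_d|=\tilde\varphi(d)$). The group $(\mathbb Z/N\mathbb Z)^\times$ acts on $J_{d_1}\times\cdots\times J_{d_q}$ componentwise by $a\cdot(j_1,\dots,j_q)=(aj_1,\dots,aj_q)$, where $aj_i$ is reduced modulo $d_i$ and replaced by its representative in $J_{d_i}$ modulo $\pm$ (for $d_i\in\{1,2\}$ the component is $1$ and stays fixed). Let $V_{\vec d}=\{j\in\{1,\dots,q\}: d_j\ge3\}$ and let $\Gamma(V_{\vec d})$ be the graph with vertex set $V_{\vec d}$ and an edge between distinct $i,j$ whenever $\gcd(d_i,d_j)\ge3$. $\tilde\beta_0(\Gamma)$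 is the reduced $0$th Betti number, i.e. the number of connected components minus one, with the convention $\tilde\beta_0(\Gamma(\emptyset))=0$. -}

module Defs where

open import Data.Bool using (Bool; true; false; if_then_else_; _∧_; _∨_; not)
open import Data.Nat using (ℕ; zero; suc; _+_; _*_; _∸_; _^_; _≤ᵇ_; _<ᵇ_; _≡ᵇ_; _/_; _%_)
open import Data.Nat.GCD using (gcd)
open import Data.Nat.LCM using (lcm)
open import Data.List using (List; []; _∷_; filter; length; map; foldr; upTo; concatMap; zipWith)
open import Data.Bool.ListAction using (all; any)
open import Data.Nat.ListAction using (product)
open import Data.Vec using (Vec; toList)
open import Relation.Nullary.Decidable using (does)
open import Relation.Unary using (Decidable)
open import Data.Bool.Properties using (T?)
open import Data.Bool using (T)

filterᵇ : {A : Set} → (A → Bool) → List A → List A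
filterᵇ p [] = []
filterᵇ p (x ∷ xs) = if p x then x ∷ filterᵇ p xs else filterᵇ p xs

countᵇ : {A : Set} → (A → Bool) → List A → ℕ
countᵇ p xs = length (filterᵇ p xs)

coprimeᵇ : ℕ → ℕ → Bool
coprimeᵇ a b = gcd a b ≡ᵇ 1

modN : ℕ → ℕ → ℕ
modN n zero = 0
modN n (suc k) = n % suc k

φ : ℕ → ℕ
φ d = countᵇ (λ j → coprimeᵇ (suc j) d) (upTo d)

φ̃ : ℕ → ℕ
φ̃ d = if d ≤ᵇ 2 then 1 else φ d / 2

J : ℕ → List ℕ
J d = if d ≤ᵇ 2 then 1 ∷ []
      else filterᵇ (λ j → (1 ≤ᵇ j) ∧ ((2 * j) <ᵇ d) ∧ coprimeᵇ j d) (upTo d)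

-- representative in J_d of the class ±r mod d (r already reduced mod d);
-- for d ∈ {1,2} the component is 1
rep : ℕ → ℕ → ℕ
rep d r = if d ≤ᵇ 2 then 1 else (if (2 * r) <ᵇ d then r else d ∸ r)

cartesian : List (List ℕ) → List (List ℕ)
cartesian [] = [] ∷ []
cartesian (xs ∷ xss) = concatMap (λ x → map (x ∷_) (cartesian xss)) xs

tuples : List ℕ → List (List ℕ)
tuples ds = cartesian (map J ds)

units : ℕ → List ℕ
units N = filterᵇ (λ a → coprimeᵇ a N) (upTo N)

act : List ℕ → ℕ → List ℕ → List ℕ
act ds a js = zipWith (λ d j → rep d (modN (a * j) d)) ds js

lex≤ : List ℕ → List ℕ → Bool
lex≤ [] _ = true
lex≤ (x ∷ xs) [] = false
lex≤ (x ∷ xs) (y ∷ ys) = (x <ᵇ y) ∨ ((x ≡ᵇ y) ∧ lex≤ xs ys)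

-- number of orbits of (ℤ/Nℤ)^× on J_{d_1} × ⋯ × J_{d_q}, N = d_1⋯d_q:
-- each orbit is counted once, via its lexicographically least element
-- (a tuple x is that element iff x ≤lex a·x for every unit a).
orb : List ℕ → ℕ
orb ds = countᵇ (λ x → all (λ a → lex≤ x (act ds a x)) (units N)) (tuples ds)
  where N = product ds

at : List ℕ → ℕ → ℕ
at [] _ = 0
at (x ∷ xs) zero = x
at (x ∷ xs) (suc i) = at xs i

vertex : List ℕ → ℕ → Bool
vertex ds i = 3 ≤ᵇ at ds i

edge : List ℕ → ℕ → ℕ → Bool
edge ds i j = vertex ds i ∧ vertex ds j ∧ not (i ≡ᵇ j) ∧ (3 ≤ᵇ gcd (at ds i) (at ds j))

walk : List ℕ → ℕ → ℕ → ℕ → Bool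
walk ds zero i j = vertex ds i ∧ (i ≡ᵇ j)
walk ds (suc k) i j =
  walk ds k i j ∨ any (λ l → edge ds i l ∧ walk ds k l j) (upTo (length ds))

-- i and j lie in the same connected component (a path has < q edges)
connected : List ℕ → ℕ → ℕ → Bool
connected ds i j = walk ds (length ds) i j

-- number of connected components: vertices that are the least vertex
-- of their component
components : List ℕ → ℕ
components ds = countᵇ
  (λ v → vertex ds v ∧ all (λ u → not (connected ds u v)) (upTo v))
  (upTo (length ds))

-- reduced 0th Betti number (components − 1, and 0 for the empty graph)
β̃₀ : List ℕ → ℕ
β̃₀ ds = components ds ∸ 1

lcmList : List ℕ → ℕ
lcmList = foldr lcm 1

{-# OPTIONS --safe #-}
-- Every tuple has the same stabiliser, the units b with b ≡ ±1 modulo every dᵢ, so counting orbits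
-- by their lexicographically least elements gives orb · |G| = |X| · |Stab|.  A unit acts only through
-- its residue mod L = lcm(d₁, …, d_q), so G may be taken to be (ℤ/Lℤ)^×, of order φ(L) = 2 φ̃(L) once
-- L ≥ 3, while |X| = ∏ φ̃(dᵢ).  A stabilising unit is determined by its signs modulo the dᵢ ≥ 3.  These
-- signs agree along the edges of Γ, as 1 ≢ -1 modulo a common divisor ≥ 3; conversely, by the Chinese
-- remainder theorem every choice of one sign per component is realised, because moduli in different
-- components have gcd at most 2.  Hence |Stab| = 2^(number of components).
module Submission where

open import Data.Bool using (Bool; true; false; if_then_else_; _∧_; _∨_; not)
import Data.Bool as Bool
open import Data.Bool.Properties using (T-≡)
open import Data.Bool.ListAction using (all; any)
open import Data.Empty using (⊥; ⊥-elim)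
open import Data.List using (List; []; _∷_; _++_; [_]; length; map; concatMap; upTo; applyUpTo)
open import Data.Nat.ListAction using (product)
open import Data.List.Properties using (≡-dec; upTo-∷ʳ; length-++; length-map; length-upTo; length-applyUpTo; map-upTo; map-cong)
open import Data.List.Membership.Propositional using (_∈_; find)
open import Data.List.Membership.Propositional.Properties using (∈-++⁻; ∈-map⁻; ∈-map⁺; ∈-concatMap⁻)
open import Data.List.Relation.Unary.Any using (here; there)
open import Data.List.Relation.Unary.All as All using (All)
open import Data.Nat
open import Data.Nat.Properties
open import Data.Nat.DivMod
open import Data.Nat.Divisibility
open import Data.Nat.GCD
open import Data.Nat.LCM using (lcm; lcm-least; m∣lcm[m,n]; n∣lcm[m,n]; gcd*lcm)
open import Data.Nat.Coprimality using (Coprime; coprime-divisor; coprime-/gcd)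
open import Data.Nat.Solver using (module +-*-Solver)
open import Data.Product using (∃; _×_; _,_; proj₁; proj₂)
open import Data.Sum using (_⊎_; inj₁; inj₂)
open import Data.Vec using (Vec; toList)
open import Function.Bundles using (Equivalence)
import Data.Vec.Relation.Unary.All as VecAll
open import Data.Vec.Relation.Unary.All.Properties using (toList⁺)
open import Algebra.Properties.CommutativeSemigroup *-commutativeSemigroup using (x∙yz≈y∙xz)
open import Algebra.Properties.CommutativeSemigroup +-commutativeSemigroup using () renaming (interchange to +-interchange)
open import Relation.Binary.Definitions using (DecidableEquality; tri<; tri≈; tri>)
open import Relation.Binary.PropositionalEquality hiding ([_]; J)
open import Relation.Nullary using (¬_; yes; no; does; Dec)
open import Defs

true≢false : true ≢ false
true≢false ()

bool-ext : ∀ {a b : Bool} → (a ≡ true → b ≡ true) → (b ≡ true → a ≡ true) → a ≡ b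
bool-ext {true} {true} f g = refl
bool-ext {true} {false} f g = sym (f refl)
bool-ext {false} {true} f g = g refl
bool-ext {false} {false} f g = refl

∧-true⁻ : ∀ {a b} → (a ∧ b) ≡ true → a ≡ true × b ≡ true
∧-true⁻ {true} {true} _ = refl , refl

∧-true⁺ : ∀ {a b} → a ≡ true → b ≡ true → (a ∧ b) ≡ true
∧-true⁺ refl refl = refl

∨-true⁻ : ∀ {a b} → (a ∨ b) ≡ true → a ≡ true ⊎ b ≡ true
∨-true⁻ {true} _ = inj₁ refl
∨-true⁻ {false} h = inj₂ h

∨-true⁺ˡ : ∀ {a} b → a ≡ true → (a ∨ b) ≡ true
∨-true⁺ˡ b refl = refl

∨-true⁺ʳ : ∀ a {b} → b ≡ true → (a ∨ b) ≡ true
∨-true⁺ʳ true h = refl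
∨-true⁺ʳ false h = h

not-true⁻ : ∀ {b} → not b ≡ true → b ≡ false
not-true⁻ {false} _ = refl

not-true⁺ : ∀ {b} → b ≡ false → not b ≡ true
not-true⁺ refl = refl

<ᵇ-true⁺ : ∀ {m n} → m < n → (m <ᵇ n) ≡ true
<ᵇ-true⁺ h = Equivalence.to T-≡ (<⇒<ᵇ h)

<ᵇ-true⁻ : ∀ {m n} → (m <ᵇ n) ≡ true → m < n
<ᵇ-true⁻ {m} {n} h = <ᵇ⇒< m n (Equivalence.from T-≡ h)

<ᵇ-false⁺ : ∀ {m n} → n ≤ m → (m <ᵇ n) ≡ false
<ᵇ-false⁺ {m} {n} h with m <ᵇ n in eq
... | true = ⊥-elim (<⇒≱ (<ᵇ-true⁻ eq) h)
... | false = refl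

<ᵇ-false⁻ : ∀ {m n} → (m <ᵇ n) ≡ false → n ≤ m
<ᵇ-false⁻ h = ≮⇒≥ (λ lt → true≢false (trans (sym (<ᵇ-true⁺ lt)) h))

≤ᵇ-true⁺ : ∀ {m n} → m ≤ n → (m ≤ᵇ n) ≡ true
≤ᵇ-true⁺ h = Equivalence.to T-≡ (≤⇒≤ᵇ h)

≤ᵇ-true⁻ : ∀ {m n} → (m ≤ᵇ n) ≡ true → m ≤ n
≤ᵇ-true⁻ {m} {n} h = ≤ᵇ⇒≤ m n (Equivalence.from T-≡ h)

≡ᵇ-true⁺ : ∀ {m n} → m ≡ n → (m ≡ᵇ n) ≡ true
≡ᵇ-true⁺ {m} {n} h = Equivalence.to T-≡ (≡⇒≡ᵇ m n h)

≡ᵇ-true⁻ : ∀ {m n} → (m ≡ᵇ n) ≡ true → m ≡ n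
≡ᵇ-true⁻ {m} {n} h = ≡ᵇ⇒≡ m n (Equivalence.from T-≡ h)

≡ᵇ-sym : ∀ m n → (m ≡ᵇ n) ≡ (n ≡ᵇ m)
≡ᵇ-sym m n = bool-ext (λ h → ≡ᵇ-true⁺ (sym (≡ᵇ-true⁻ {m} h))) (λ h → ≡ᵇ-true⁺ (sym (≡ᵇ-true⁻ {n} h)))

eqb : {A : Set} → DecidableEquality A → A → A → Bool
eqb _≟_ x y = does (x ≟ y)

module _ {A : Set} (_≟_ : DecidableEquality A) where

  eqb-true⁺ : ∀ {x y} → x ≡ y → eqb _≟_ x y ≡ true
  eqb-true⁺ {x} {y} e with x ≟ y
  ... | yes _ = refl
  ... | no ne = ⊥-elim (ne e)

  eqb-true⁻ : ∀ {x y} → eqb _≟_ x y ≡ true → x ≡ y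
  eqb-true⁻ {x} {y} h with x ≟ y
  ... | yes e = e

  eqb-false⁺ : ∀ {x y} → x ≢ y → eqb _≟_ x y ≡ false
  eqb-false⁺ {x} {y} ne with x ≟ y
  ... | yes e = ⊥-elim (ne e)
  ... | no _ = refl

  eqb-refl : ∀ x → eqb _≟_ x x ≡ true
  eqb-refl x = eqb-true⁺ refl

  eqb-sym : ∀ x y → eqb _≟_ x y ≡ eqb _≟_ y x
  eqb-sym x y = bool-ext (λ h → eqb-true⁺ (sym (eqb-true⁻ h))) (λ h → eqb-true⁺ (sym (eqb-true⁻ h)))

eqb-cong : {A B : Set} (_≟₁_ : DecidableEquality A) (_≟₂_ : DecidableEquality B) {x y : A} {u v : B} →
  (x ≡ y → u ≡ v) → (u ≡ v → x ≡ y) → eqb _≟₁_ x y ≡ eqb _≟₂_ u v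
eqb-cong d₁ d₂ f g = bool-ext (λ h → eqb-true⁺ d₂ (f (eqb-true⁻ d₁ h))) (λ h → eqb-true⁺ d₁ (g (eqb-true⁻ d₂ h)))

module _ {A : Set} (p : A → Bool) where

  any-true⁻ : ∀ xs → any p xs ≡ true → ∃ λ x → x ∈ xs × p x ≡ true
  any-true⁻ (x ∷ xs) h with p x in eq
  ... | true = x , here refl , eq
  ... | false = let y , m , e = any-true⁻ xs h in y , there m , e

  any-true⁺ : ∀ xs {x} → x ∈ xs → p x ≡ true → any p xs ≡ true
  any-true⁺ (y ∷ xs) (here refl) e rewrite e = refl
  any-true⁺ (y ∷ xs) (there m) e = ∨-true⁺ʳ (p y) (any-true⁺ xs m e)

  any-false⁻ : ∀ xs → any p xs ≡ false → ∀ {x} → x ∈ xs → p x ≡ false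
  any-false⁻ xs h {x} m with p x in eq
  ... | false = refl
  ... | true = ⊥-elim (true≢false (trans (sym (any-true⁺ xs m eq)) h))

  all-true⁻ : ∀ xs → all p xs ≡ true → ∀ {x} → x ∈ xs → p x ≡ true
  all-true⁻ (y ∷ xs) h (here refl) = proj₁ (∧-true⁻ h)
  all-true⁻ (y ∷ xs) h (there m) = all-true⁻ xs (proj₂ (∧-true⁻ {p y} h)) m

  all-true⁺ : ∀ xs → (∀ {x} → x ∈ xs → p x ≡ true) → all p xs ≡ true
  all-true⁺ [] h = refl
  all-true⁺ (y ∷ xs) h = ∧-true⁺ (h (here refl)) (all-true⁺ xs (λ m → h (there m)))

  all-false⁻ : ∀ xs → all p xs ≡ false → ∃ λ x → x ∈ xs × p x ≡ false
  all-false⁻ (x ∷ xs) h with p x in eq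
  ... | false = x , here refl , eq
  ... | true = let y , m , e = all-false⁻ xs h in y , there m , e

any-cong : {A : Set} {p p′ : A → Bool} → (∀ x → p x ≡ p′ x) → ∀ xs → any p xs ≡ any p′ xs
any-cong h [] = refl
any-cong h (x ∷ xs) = cong₂ _∨_ (h x) (any-cong h xs)

𝟙 : Bool → ℕ
𝟙 true = 1
𝟙 false = 0

𝟙-∧ : ∀ a b → 𝟙 (a ∧ b) ≡ 𝟙 a * 𝟙 b
𝟙-∧ true b = sym (+-identityʳ (𝟙 b))
𝟙-∧ false b = refl

𝟙≢0⇒≡true : ∀ {b} → 𝟙 b ≢ 0 → b ≡ true
𝟙≢0⇒≡true {true} _ = refl
𝟙≢0⇒≡true {false} h = ⊥-elim (h refl)

𝟙-mono : ∀ {a b} → (a ≡ true → b ≡ true) → 𝟙 a ≤ 𝟙 b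
𝟙-mono {false} h = z≤n
𝟙-mono {true} h rewrite h refl = ≤-refl

𝟙≤1 : ∀ a → 𝟙 a ≤ 1
𝟙≤1 true = ≤-refl
𝟙≤1 false = z≤n

∑ : {A : Set} → (A → ℕ) → List A → ℕ
∑ f [] = 0
∑ f (x ∷ xs) = f x + ∑ f xs

module _ {A : Set} where

  countᵇ≡∑ : (p : A → Bool) (xs : List A) → countᵇ p xs ≡ ∑ (λ x → 𝟙 (p x)) xs
  countᵇ≡∑ p [] = refl
  countᵇ≡∑ p (x ∷ xs) with p x
  ... | true = cong suc (countᵇ≡∑ p xs)
  ... | false = countᵇ≡∑ p xs

  ∑-cong : {f g : A → ℕ} (xs : List A) → (∀ x → x ∈ xs → f x ≡ g x) → ∑ f xs ≡ ∑ g xs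
  ∑-cong [] h = refl
  ∑-cong (x ∷ xs) h = cong₂ _+_ (h x (here refl)) (∑-cong xs (λ y m → h y (there m)))

  ∑-++ : (f : A → ℕ) (xs ys : List A) → ∑ f (xs ++ ys) ≡ ∑ f xs + ∑ f ys
  ∑-++ f [] ys = refl
  ∑-++ f (x ∷ xs) ys = trans (cong (f x +_) (∑-++ f xs ys)) (sym (+-assoc (f x) _ _))

  ∑-+ : (f g : A → ℕ) (xs : List A) → ∑ (λ x → f x + g x) xs ≡ ∑ f xs + ∑ g xs
  ∑-+ f g [] = refl
  ∑-+ f g (x ∷ xs) rewrite ∑-+ f g xs = +-interchange (f x) (g x) (∑ f xs) (∑ g xs)

  ∑-*ʳ : (f : A → ℕ) (k : ℕ) (xs : List A) → ∑ (λ x → f x * k) xs ≡ ∑ f xs * k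
  ∑-*ʳ f k [] = refl
  ∑-*ʳ f k (x ∷ xs) rewrite ∑-*ʳ f k xs = sym (*-distribʳ-+ k (f x) (∑ f xs))

  ∑-*ˡ : (k : ℕ) (f : A → ℕ) (xs : List A) → ∑ (λ x → k * f x) xs ≡ k * ∑ f xs
  ∑-*ˡ k f [] = sym (*-zeroʳ k)
  ∑-*ˡ k f (x ∷ xs) rewrite ∑-*ˡ k f xs = sym (*-distribˡ-+ k (f x) (∑ f xs))

  ∑-const : (k : ℕ) (xs : List A) → ∑ (λ _ → k) xs ≡ length xs * k
  ∑-const k [] = refl
  ∑-const k (x ∷ xs) = cong (k +_) (∑-const k xs)

  ∑-count-const : (xs : List A) → ∑ (λ _ → 1) xs ≡ length xs
  ∑-count-const xs = trans (∑-const 1 xs) (*-identityʳ (length xs))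

  ∑-zero : (f : A → ℕ) (xs : List A) → (∀ x → x ∈ xs → f x ≡ 0) → ∑ f xs ≡ 0
  ∑-zero f xs h = trans (∑-cong xs h) (trans (∑-const 0 xs) (*-zeroʳ (length xs)))

  ∑≢0⇒∃≢0 : (f : A → ℕ) (xs : List A) → ∑ f xs ≢ 0 → ∃ λ x → x ∈ xs × f x ≢ 0
  ∑≢0⇒∃≢0 f [] h = ⊥-elim (h refl)
  ∑≢0⇒∃≢0 f (x ∷ xs) h with f x ≟ 0
  ... | no ne = x , here refl , ne
  ... | yes e = let y , m , ne = ∑≢0⇒∃≢0 f xs (λ z → h (trans (cong (_+ ∑ f xs) e) z)) in y , there m , ne

  ∑𝟙≡0⇒false : (p : A → Bool) (xs : List A) → ∑ (λ x → 𝟙 (p x)) xs ≡ 0 → ∀ x → x ∈ xs → p x ≡ false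
  ∑𝟙≡0⇒false p (y ∷ xs) h x (here refl) with p y
  ... | false = refl
  ∑𝟙≡0⇒false p (y ∷ xs) h x (there m) with p y
  ... | false = ∑𝟙≡0⇒false p xs h x m

  ∑𝟙≤length : (p : A → Bool) (xs : List A) → ∑ (λ x → 𝟙 (p x)) xs ≤ length xs
  ∑𝟙≤length p [] = z≤n
  ∑𝟙≤length p (x ∷ xs) = +-mono-≤ (𝟙≤1 (p x)) (∑𝟙≤length p xs)

  ∑𝟙-mono : (p p′ : A → Bool) (xs : List A) → (∀ x → x ∈ xs → p x ≡ true → p′ x ≡ true) →
    ∑ (λ x → 𝟙 (p x)) xs ≤ ∑ (λ x → 𝟙 (p′ x)) xs
  ∑𝟙-mono p p′ [] h = z≤n
  ∑𝟙-mono p p′ (x ∷ xs) h = +-mono-≤ (𝟙-mono (h x (here refl))) (∑𝟙-mono p p′ xs (λ y m → h y (there m)))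

  ∑𝟙-mono-< : (p p′ : A → Bool) (xs : List A) → (∀ x → x ∈ xs → p x ≡ true → p′ x ≡ true) →
    ∀ {x₀} → x₀ ∈ xs → p′ x₀ ≡ true → p x₀ ≡ false →
    ∑ (λ x → 𝟙 (p x)) xs < ∑ (λ x → 𝟙 (p′ x)) xs
  ∑𝟙-mono-< p p′ (x ∷ xs) h (here refl) e₁ e₂ rewrite e₁ | e₂ = s≤s (∑𝟙-mono p p′ xs (λ y m → h y (there m)))
  ∑𝟙-mono-< p p′ (x ∷ xs) h (there m) e₁ e₂ =
    subst (_≤ ∑ (λ y → 𝟙 (p′ y)) (x ∷ xs)) (+-suc (𝟙 (p x)) (∑ (λ y → 𝟙 (p y)) xs))
      (+-mono-≤ (𝟙-mono (h x (here refl))) (∑𝟙-mono-< p p′ xs (λ y m′ → h y (there m′)) m e₁ e₂))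

  ∈-filterᵇ⁻ : (p : A → Bool) (xs : List A) {x : A} → x ∈ filterᵇ p xs → x ∈ xs × p x ≡ true
  ∈-filterᵇ⁻ p (y ∷ xs) m with p y in eq
  ∈-filterᵇ⁻ p (y ∷ xs) (here refl) | true = here refl , eq
  ∈-filterᵇ⁻ p (y ∷ xs) (there m) | true = let a , b = ∈-filterᵇ⁻ p xs m in there a , b
  ∈-filterᵇ⁻ p (y ∷ xs) m | false = let a , b = ∈-filterᵇ⁻ p xs m in there a , b

  ∑-filterᵇ : (f : A → ℕ) (p : A → Bool) (xs : List A) → ∑ f (filterᵇ p xs) ≡ ∑ (λ x → 𝟙 (p x) * f x) xs
  ∑-filterᵇ f p [] = refl
  ∑-filterᵇ f p (x ∷ xs) with p x
  ... | true = cong₂ _+_ (sym (+-identityʳ (f x))) (∑-filterᵇ f p xs)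
  ... | false = ∑-filterᵇ f p xs

module _ {A B : Set} where

  ∑-map : (f : B → ℕ) (g : A → B) (xs : List A) → ∑ f (map g xs) ≡ ∑ (λ x → f (g x)) xs
  ∑-map f g [] = refl
  ∑-map f g (x ∷ xs) = cong (f (g x) +_) (∑-map f g xs)

  ∑-concatMap : (f : B → ℕ) (g : A → List B) (xs : List A) → ∑ f (concatMap g xs) ≡ ∑ (λ x → ∑ f (g x)) xs
  ∑-concatMap f g [] = refl
  ∑-concatMap f g (x ∷ xs) = trans (∑-++ f (g x) (concatMap g xs)) (cong (∑ f (g x) +_) (∑-concatMap f g xs))

  ∑-swap : (f : A → B → ℕ) (xs : List A) (ys : List B) →
    ∑ (λ x → ∑ (f x) ys) xs ≡ ∑ (λ y → ∑ (λ x → f x y) xs) ys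
  ∑-swap f [] ys = sym (∑-zero _ ys (λ _ _ → refl))
  ∑-swap f (x ∷ xs) ys = trans (cong (∑ (f x) ys +_) (∑-swap f xs ys)) (sym (∑-+ (f x) _ ys))

  double-counting : (r : A → B → ℕ) (F : A → ℕ) (G : B → ℕ) (xs : List A) (ys : List B) →
    (∀ x → x ∈ xs → ∑ (r x) ys ≡ F x) → (∀ y → y ∈ ys → ∑ (λ x → r x y) xs ≡ G y) →
    ∑ F xs ≡ ∑ G ys
  double-counting r F G xs ys hx hy = trans (sym (∑-cong xs hx)) (trans (∑-swap r xs ys) (∑-cong ys hy))

record Enumerates {A : Set} (_≟_ : DecidableEquality A) (mem : A → Bool) (xs : List A) : Set where
  field
    sound : ∀ {x} → x ∈ xs → mem x ≡ true
    once  : ∀ z → mem z ≡ true → ∑ (λ x → 𝟙 (eqb _≟_ x z)) xs ≡ 1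
open Enumerates public

module _ {A : Set} {_≟_ : DecidableEquality A} {mem : A → Bool} {xs : List A} (E : Enumerates _≟_ mem xs) where

  complete : ∀ {z} → mem z ≡ true → z ∈ xs
  complete {z} h with ∑≢0⇒∃≢0 (λ x → 𝟙 (eqb _≟_ x z)) xs (λ e → 1≢0 (trans (sym (once E z h)) e))
    where 1≢0 : 1 ≢ 0
          1≢0 ()
  ... | x , m , ne = subst (_∈ xs) (eqb-true⁻ _≟_ (𝟙≢0⇒≡true ne)) m

  count-unique : (p : A → Bool) (z : A) → mem z ≡ true → p z ≡ true →
    (∀ x → x ∈ xs → p x ≡ true → x ≡ z) → ∑ (λ x → 𝟙 (p x)) xs ≡ 1
  count-unique p z mz pz h = trans (∑-cong xs same) (once E z mz)
    where
    same : ∀ x → x ∈ xs → 𝟙 (p x) ≡ 𝟙 (eqb _≟_ x z)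
    same x m = cong 𝟙 (bool-ext (λ px → eqb-true⁺ _≟_ (h x m px)) (λ e → subst (λ t → p t ≡ true) (sym (eqb-true⁻ _≟_ e)) pz))

  count-none : (p : A → Bool) → (∀ x → x ∈ xs → p x ≡ false) → ∑ (λ x → 𝟙 (p x)) xs ≡ 0
  count-none p h = ∑-zero _ xs (λ x m → cong 𝟙 (h x m))

  ∑-single : (f : A → ℕ) (z : A) → mem z ≡ true → ∑ (λ x → 𝟙 (eqb _≟_ x z) * f x) xs ≡ f z
  ∑-single f z mz = trans (∑-cong xs at-z) (trans (∑-*ʳ _ (f z) xs) (trans (cong (_* f z) (once E z mz)) (+-identityʳ (f z))))
    where
    at-z : ∀ x → x ∈ xs → 𝟙 (eqb _≟_ x z) * f x ≡ 𝟙 (eqb _≟_ x z) * f z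
    at-z x m with x ≟ z
    ... | yes refl = refl
    ... | no _ = refl

  filterᵇ-enumerates : (p : A → Bool) → Enumerates _≟_ (λ x → p x ∧ mem x) (filterᵇ p xs)
  filterᵇ-enumerates p = record { sound = snd ; once = onc }
    where
    snd : ∀ {x} → x ∈ filterᵇ p xs → (p x ∧ mem x) ≡ true
    snd m = let a , b = ∈-filterᵇ⁻ p xs m in ∧-true⁺ b (sound E a)
    onc : ∀ z → (p z ∧ mem z) ≡ true → ∑ (λ x → 𝟙 (eqb _≟_ x z)) (filterᵇ p xs) ≡ 1
    onc z h = let pz , mz = ∧-true⁻ {p z} h in
      trans (∑-filterᵇ _ p xs)
        (trans (∑-cong xs (λ x _ → sym (𝟙-∧ (p x) (eqb _≟_ x z))))
          (count-unique (λ x → p x ∧ eqb _≟_ x z) z mz (∧-true⁺ pz (eqb-refl _≟_ z))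
            (λ x _ e → eqb-true⁻ _≟_ (proj₂ (∧-true⁻ {p x} e)))))

  count-by-bijection : {B : Set} (P : B → Bool) (f : B → A) (bs : List B) →
    (∀ b → b ∈ bs → P b ≡ true → mem (f b) ≡ true) →
    (∀ x → x ∈ xs → ∑ (λ b → 𝟙 (P b ∧ eqb _≟_ (f b) x)) bs ≡ 1) →
    ∑ (λ b → 𝟙 (P b)) bs ≡ length xs
  count-by-bijection P f bs into one-preimage =
    trans (double-counting (λ b x → 𝟙 (P b ∧ eqb _≟_ (f b) x)) (λ b → 𝟙 (P b)) (λ _ → 1) bs xs byB one-preimage)
          (∑-count-const xs)
    where
    byB : ∀ b → b ∈ bs → ∑ (λ x → 𝟙 (P b ∧ eqb _≟_ (f b) x)) xs ≡ 𝟙 (P b)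
    byB b bm with P b in pb
    ... | true = trans (∑-cong xs (λ x _ → cong 𝟙 (eqb-sym _≟_ (f b) x))) (once E (f b) (into b bm pb))
    ... | false = count-none (λ _ → false) (λ _ _ → refl)

∈-upTo⁻ : ∀ n {x} → x ∈ upTo n → x < n
∈-upTo⁻ (suc n) {x} m rewrite sym (upTo-∷ʳ n) with ∈-++⁻ (upTo n) m
... | inj₁ m′ = m≤n⇒m≤1+n (∈-upTo⁻ n m′)
... | inj₂ (here refl) = ≤-refl

upTo-enumerates : ∀ n → Enumerates _≟_ (λ x → x <ᵇ n) (upTo n)
upTo-enumerates n = record { sound = λ m → <ᵇ-true⁺ (∈-upTo⁻ n m) ; once = λ z h → go n z (<ᵇ-true⁻ h) }
  where
  go : ∀ n z → z < n → ∑ (λ x → 𝟙 (eqb _≟_ x z)) (upTo n) ≡ 1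
  go (suc n) z z<n = trans (cong (∑ (λ x → 𝟙 (eqb _≟_ x z))) (sym (upTo-∷ʳ n)))
    (trans (∑-++ (λ x → 𝟙 (eqb _≟_ x z)) (upTo n) [ n ]) (last (n ≟ z)))
    where
    last : Dec (n ≡ z) → ∑ (λ x → 𝟙 (eqb _≟_ x z)) (upTo n) + (𝟙 (eqb _≟_ n z) + 0) ≡ 1
    last (yes refl) = cong₂ _+_ (∑-zero _ (upTo n) (λ x m → cong 𝟙 (eqb-false⁺ _≟_ (λ e → <-irrefl e (∈-upTo⁻ n m)))))
                                (cong (λ b → 𝟙 b + 0) (eqb-refl _≟_ n))
    last (no ne) = trans (cong (λ b → ∑ (λ x → 𝟙 (eqb _≟_ x z)) (upTo n) + (𝟙 b + 0)) (eqb-false⁺ _≟_ ne))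
      (trans (+-identityʳ _) (go n z (≤∧≢⇒< (≤-pred z<n) (λ e → ne (sym e)))))

∈-upTo⁺ : ∀ {n x} → x < n → x ∈ upTo n
∈-upTo⁺ {n} lt = complete (upTo-enumerates n) (<ᵇ-true⁺ lt)

singleton-enumerates : ∀ x → Enumerates _≟_ (λ z → eqb _≟_ z x) [ x ]
singleton-enumerates x = record
  { sound = λ { (here refl) → eqb-refl _≟_ x }
  ; once = λ z h → cong (λ t → 𝟙 t + 0) (trans (cong (eqb _≟_ x) (eqb-true⁻ _≟_ h)) (eqb-refl _≟_ x)) }

prepend : {A : Set} → List A → List (List A) → List (List A)
prepend xs yss = concatMap (λ x → map (x ∷_) yss) xs

consMem : {A : Set} → (A → Bool) → (List A → Bool) → List A → Bool
consMem m M [] = false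
consMem m M (z ∷ zs) = m z ∧ M zs

nilMem : {A : Set} → List A → Bool
nilMem [] = true
nilMem (_ ∷ _) = false

nil-enumerates : {A : Set} (_≟_ : DecidableEquality A) → Enumerates (≡-dec _≟_) nilMem [ [] ]
nil-enumerates _ = record { sound = λ { (here refl) → refl } ; once = λ { [] _ → refl } }

module _ {A : Set} {_≟_ : DecidableEquality A} {m : A → Bool} {xs : List A} (E : Enumerates _≟_ m xs)
         {M : List A → Bool} {yss : List (List A)} (F : Enumerates (≡-dec _≟_) M yss) where

  prepend-enumerates : Enumerates (≡-dec _≟_) (consMem m M) (prepend xs yss)
  prepend-enumerates = record { sound = snd ; once = onc }
    where
    snd : ∀ {w} → w ∈ prepend xs yss → consMem m M w ≡ true
    snd wm with find (∈-concatMap⁻ (λ x → map (x ∷_) yss) {xs = xs} wm)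
    ... | x , xm , wm′ with ∈-map⁻ (x ∷_) wm′
    ... | ys , ym , refl = ∧-true⁺ (sound E xm) (sound F ym)
    onc : ∀ w → consMem m M w ≡ true → ∑ (λ u → 𝟙 (eqb (≡-dec _≟_) u w)) (prepend xs yss) ≡ 1
    onc (z ∷ zs) h = begin
      ∑ (λ u → 𝟙 (u ==ᴸ (z ∷ zs))) (prepend xs yss)              ≡⟨ ∑-concatMap _ (λ x → map (x ∷_) yss) xs ⟩
      ∑ (λ x → ∑ (λ u → 𝟙 (u ==ᴸ (z ∷ zs))) (map (x ∷_) yss)) xs ≡⟨ ∑-cong xs (λ x _ → row x) ⟩
      ∑ (λ x → 𝟙 (eqb _≟_ x z)) xs                              ≡⟨ once E z (proj₁ (∧-true⁻ {m z} h)) ⟩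
      1                                                         ∎
      where
      open ≡-Reasoning
      _==ᴸ_ = eqb (≡-dec _≟_)
      row : ∀ x → ∑ (λ u → 𝟙 (u ==ᴸ (z ∷ zs))) (map (x ∷_) yss) ≡ 𝟙 (eqb _≟_ x z)
      row x = begin
        ∑ (λ u → 𝟙 (u ==ᴸ (z ∷ zs))) (map (x ∷_) yss)         ≡⟨ ∑-map _ (x ∷_) yss ⟩
        ∑ (λ ys → 𝟙 (eqb _≟_ x z ∧ (ys ==ᴸ zs))) yss          ≡⟨ ∑-cong yss (λ ys _ → 𝟙-∧ (eqb _≟_ x z) _) ⟩
        ∑ (λ ys → 𝟙 (eqb _≟_ x z) * 𝟙 (ys ==ᴸ zs)) yss        ≡⟨ ∑-*ˡ (𝟙 (eqb _≟_ x z)) _ yss ⟩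
        𝟙 (eqb _≟_ x z) * ∑ (λ ys → 𝟙 (ys ==ᴸ zs)) yss        ≡⟨ cong (𝟙 (eqb _≟_ x z) *_) (once F zs (proj₂ (∧-true⁻ {m z} h))) ⟩
        𝟙 (eqb _≟_ x z) * 1                                   ≡⟨ *-identityʳ _ ⟩
        𝟙 (eqb _≟_ x z)                                       ∎

length-prepend : {A : Set} (xs : List A) (yss : List (List A)) → length (prepend xs yss) ≡ length xs * length yss
length-prepend [] yss = refl
length-prepend (x ∷ xs) yss = trans (length-++ (map (x ∷_) yss)) (cong₂ _+_ (length-map (x ∷_) yss) (length-prepend xs yss))

-- Orbit counting

record FiniteAction (G X : Set) : Set₁ where
  field
    _≟ᴳ_ : DecidableEquality G
    _≟ˣ_ : DecidableEquality X
    group : List G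
    memG : G → Bool
    group-enum : Enumerates _≟ᴳ_ memG group
    points : List X
    memX : X → Bool
    points-enum : Enumerates _≟ˣ_ memX points
    _·_ : G → X → X
    _∙_ : G → G → G
    _⁻¹ : G → G
    ε : G
    ·-closed : ∀ {a x} → memG a ≡ true → memX x ≡ true → memX (a · x) ≡ true
    ∙-closed : ∀ {a b} → memG a ≡ true → memG b ≡ true → memG (a ∙ b) ≡ true
    ⁻¹-closed : ∀ {a} → memG a ≡ true → memG (a ⁻¹) ≡ true
    ε-closed : memG ε ≡ true
    ·-∙ : ∀ {a b x} → memG a ≡ true → memG b ≡ true → memX x ≡ true → (a ∙ b) · x ≡ a · (b · x)
    ·-ε : ∀ {x} → memX x ≡ true → ε · x ≡ x
    ⁻¹-·-cancel : ∀ {a x} → memG a ≡ true → memX x ≡ true → (a ⁻¹) · (a · x) ≡ x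
    ·-⁻¹-cancel : ∀ {a x} → memG a ≡ true → memX x ≡ true → a · ((a ⁻¹) · x) ≡ x
    ∙-⁻¹-cancel : ∀ {a b} → memG a ≡ true → memG b ≡ true → a ∙ ((a ⁻¹) ∙ b) ≡ b
    ⁻¹-∙-cancel : ∀ {a b} → memG a ≡ true → memG b ≡ true → (a ⁻¹) ∙ (a ∙ b) ≡ b
    _≤ˣ_ : X → X → Bool
    ≤ˣ-total : ∀ x y → (x ≤ˣ y) ≡ true ⊎ (y ≤ˣ x) ≡ true
    ≤ˣ-antisym : ∀ {x y} → (x ≤ˣ y) ≡ true → (y ≤ˣ x) ≡ true → x ≡ y
    ≤ˣ-trans : ∀ {x y z} → (x ≤ˣ y) ≡ true → (y ≤ˣ z) ≡ true → (x ≤ˣ z) ≡ true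
    minimal : X → Bool
    minimal-sound : ∀ {x} → memX x ≡ true → minimal x ≡ true → ∀ a → memG a ≡ true → (x ≤ˣ (a · x)) ≡ true
    minimal-complete : ∀ {x} → memX x ≡ true → (∀ a → memG a ≡ true → (x ≤ˣ (a · x)) ≡ true) → minimal x ≡ true
    stabiliser-size : ℕ
    stabiliser : ∀ x → memX x ≡ true → ∑ (λ b → 𝟙 (eqb _≟ˣ_ (b · x) x)) group ≡ stabiliser-size

module OrbitCounting {G X : Set} (A : FiniteAction G X) where
  open FiniteAction A

  private
    _==_ : X → X → Bool
    x == y = eqb _≟ˣ_ x y

    S = stabiliser-size

  inOrbit : X → X → Bool
  inOrbit x y = any (λ a → (a · x) == y) group

  orbitSize : X → ℕ
  orbitSize x = ∑ (λ y → 𝟙 (inOrbit x y)) points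

  -- b ↦ a₀⁻¹ ∙ b maps {b | b · x = a₀ · x} bijectively onto the stabiliser of x.
  fibre-size : ∀ x a₀ → memX x ≡ true → memG a₀ ≡ true → ∑ (λ a → 𝟙 ((a · x) == (a₀ · x))) group ≡ S
  fibre-size x a₀ mx ma₀ =
    trans (double-counting r (λ a → 𝟙 ((a · x) == (a₀ · x))) (λ b → 𝟙 ((b · x) == x)) group group byA byB) (stabiliser x mx)
    where
    r : G → G → ℕ
    r a b = 𝟙 (eqb _≟ᴳ_ b ((a₀ ⁻¹) ∙ a)) * 𝟙 ((b · x) == x)
    byA : ∀ a → a ∈ group → ∑ (r a) group ≡ 𝟙 ((a · x) == (a₀ · x))
    byA a am = trans (∑-single group-enum (λ b → 𝟙 ((b · x) == x)) ((a₀ ⁻¹) ∙ a) (∙-closed (⁻¹-closed ma₀) ma))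
                     (cong 𝟙 (eqb-cong _≟ˣ_ _≟ˣ_ fwd bwd))
      where
      ma = sound group-enum am
      fwd : ((a₀ ⁻¹) ∙ a) · x ≡ x → a · x ≡ a₀ · x
      fwd h = trans (sym (·-⁻¹-cancel ma₀ (·-closed ma mx))) (cong (a₀ ·_) (trans (sym (·-∙ (⁻¹-closed ma₀) ma mx)) h))
      bwd : a · x ≡ a₀ · x → ((a₀ ⁻¹) ∙ a) · x ≡ x
      bwd h = trans (·-∙ (⁻¹-closed ma₀) ma mx) (trans (cong ((a₀ ⁻¹) ·_) h) (⁻¹-·-cancel ma₀ mx))
    byB : ∀ b → b ∈ group → ∑ (λ a → r a b) group ≡ 𝟙 ((b · x) == x)
    byB b bm = trans (∑-cong group r≡indicator) (∑-single group-enum (λ _ → 𝟙 ((b · x) == x)) (a₀ ∙ b) (∙-closed ma₀ mb))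
      where
      mb = sound group-enum bm
      r≡indicator : ∀ a → a ∈ group → r a b ≡ 𝟙 (eqb _≟ᴳ_ a (a₀ ∙ b)) * 𝟙 ((b · x) == x)
      r≡indicator a am = cong (λ t → 𝟙 t * 𝟙 ((b · x) == x)) (eqb-cong _≟ᴳ_ _≟ᴳ_
        (λ h → trans (sym (∙-⁻¹-cancel ma₀ (sound group-enum am))) (cong (a₀ ∙_) (sym h)))
        (λ h → trans (sym (⁻¹-∙-cancel ma₀ mb)) (cong ((a₀ ⁻¹) ∙_) (sym h))))

  orbit-stabiliser : ∀ x → memX x ≡ true → orbitSize x * S ≡ length group
  orbit-stabiliser x mx = trans (sym (∑-*ʳ _ S points))
    (trans (double-counting (λ y a → 𝟙 ((a · x) == y)) (λ y → 𝟙 (inOrbit x y) * S) (λ _ → 1) points group byY byA)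
      (∑-count-const group))
    where
    byY : ∀ y → y ∈ points → ∑ (λ a → 𝟙 ((a · x) == y)) group ≡ 𝟙 (inOrbit x y) * S
    byY y _ with inOrbit x y in eq
    ... | true with any-true⁻ (λ a → (a · x) == y) group eq
    ...   | a₀ , a₀m , h with eqb-true⁻ _≟ˣ_ h
    ...     | refl = trans (fibre-size x a₀ mx (sound group-enum a₀m)) (sym (+-identityʳ S))
    byY y _ | false = ∑-zero _ group (λ a am → cong 𝟙 (any-false⁻ _ group eq am))
    byA : ∀ a → a ∈ group → ∑ (λ y → 𝟙 ((a · x) == y)) points ≡ 1
    byA a am = trans (∑-cong points (λ y _ → cong 𝟙 (eqb-sym _≟ˣ_ (a · x) y)))
                     (once points-enum (a · x) (·-closed (sound group-enum am) mx))

  ≤ˣ-refl : ∀ x → (x ≤ˣ x) ≡ true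
  ≤ˣ-refl x with ≤ˣ-total x x
  ... | inj₁ h = h
  ... | inj₂ h = h

  minOf : X → List X → X
  minOf m [] = m
  minOf m (x ∷ xs) = minOf (if m ≤ˣ x then m else x) xs

  minOf-∈ : ∀ m xs → minOf m xs ≡ m ⊎ minOf m xs ∈ xs
  minOf-∈ m [] = inj₁ refl
  minOf-∈ m (x ∷ xs) with m ≤ˣ x
  ... | true with minOf-∈ m xs
  ...   | inj₁ h = inj₁ h
  ...   | inj₂ h = inj₂ (there h)
  minOf-∈ m (x ∷ xs) | false with minOf-∈ x xs
  ...   | inj₁ h = inj₂ (here h)
  ...   | inj₂ h = inj₂ (there h)

  minOf-≤ : ∀ m xs z → z ∈ (m ∷ xs) → (minOf m xs ≤ˣ z) ≡ true
  minOf-≤ m [] z (here refl) = ≤ˣ-refl m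
  minOf-≤ m (x ∷ xs) z zm with m ≤ˣ x in eq
  minOf-≤ m (x ∷ xs) z (here refl) | true = minOf-≤ m xs m (here refl)
  minOf-≤ m (x ∷ xs) z (there (here refl)) | true = ≤ˣ-trans (minOf-≤ m xs m (here refl)) eq
  minOf-≤ m (x ∷ xs) z (there (there zm)) | true = minOf-≤ m xs z (there zm)
  minOf-≤ m (x ∷ xs) z (here refl) | false = ≤ˣ-trans (minOf-≤ x xs x (here refl)) x≤m
    where
    x≤m : (x ≤ˣ m) ≡ true
    x≤m with ≤ˣ-total m x
    ... | inj₁ h = ⊥-elim (true≢false (trans (sym h) eq))
    ... | inj₂ h = h
  minOf-≤ m (x ∷ xs) z (there (here refl)) | false = minOf-≤ x xs x (here refl)
  minOf-≤ m (x ∷ xs) z (there (there zm)) | false = minOf-≤ x xs z (there zm)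

  -- The witness is the least element of the orbit list [ a · y | a ∈ group ].
  one-minimal-per-orbit : ∀ y → y ∈ points → ∑ (λ x → 𝟙 (minimal x ∧ inOrbit x y)) points ≡ 1
  one-minimal-per-orbit y ym = count-unique points-enum (λ x → minimal x ∧ inOrbit x y) z mz (∧-true⁺ minz orbz) uniq
    where
    my = sound points-enum ym
    z = minOf y (map (_· y) group)
    z-form : ∃ λ a₁ → memG a₁ ≡ true × z ≡ a₁ · y
    z-form with minOf-∈ y (map (_· y) group)
    ... | inj₁ h = ε , ε-closed , trans h (sym (·-ε my))
    ... | inj₂ h = let a₁ , a₁m , eq = ∈-map⁻ (_· y) h in a₁ , sound group-enum a₁m , eq
    a₁ = proj₁ z-form
    ma₁ = proj₁ (proj₂ z-form)
    z≡ = proj₂ (proj₂ z-form)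
    z≤ : ∀ a → memG a ≡ true → (z ≤ˣ (a · y)) ≡ true
    z≤ a ma = minOf-≤ y (map (_· y) group) (a · y) (there (∈-map⁺ (_· y) (complete group-enum ma)))
    mz : memX z ≡ true
    mz = subst (λ t → memX t ≡ true) (sym z≡) (·-closed ma₁ my)
    minz : minimal z ≡ true
    minz = minimal-complete mz (λ a ma → subst (λ t → (z ≤ˣ t) ≡ true)
      (trans (·-∙ ma ma₁ my) (cong (a ·_) (sym z≡))) (z≤ (a ∙ a₁) (∙-closed ma ma₁)))
    orbz : inOrbit z y ≡ true
    orbz = any-true⁺ (λ a → (a · z) == y) group (complete group-enum (⁻¹-closed ma₁))
      (subst (λ t → ((a₁ ⁻¹) · t) == y ≡ true) (sym z≡) (subst (λ t → (t == y) ≡ true) (sym (⁻¹-·-cancel ma₁ my)) (eqb-refl _≟ˣ_ y)))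
    uniq : ∀ x → x ∈ points → (minimal x ∧ inOrbit x y) ≡ true → x ≡ z
    uniq x xm h with ∧-true⁻ {minimal x} h
    ... | mp , ob with any-true⁻ (λ a → (a · x) == y) group ob
    ...   | a , am , ea with eqb-true⁻ _≟ˣ_ ea
    ...     | refl = ≤ˣ-antisym x≤z z≤x
      where
      mx = sound points-enum xm
      ma = sound group-enum am
      x≤z : (x ≤ˣ z) ≡ true
      x≤z = subst (λ t → (x ≤ˣ t) ≡ true) (trans (·-∙ ma₁ ma mx) (sym z≡)) (minimal-sound mx mp (a₁ ∙ a) (∙-closed ma₁ ma))
      z≤x : (z ≤ˣ x) ≡ true
      z≤x = subst (λ t → (z ≤ˣ t) ≡ true) (⁻¹-·-cancel ma mx) (z≤ (a ⁻¹) (⁻¹-closed ma))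

  ∑-orbitSize-minimal : ∑ (λ x → 𝟙 (minimal x) * orbitSize x) points ≡ length points
  ∑-orbitSize-minimal =
    trans (double-counting (λ x y → 𝟙 (minimal x ∧ inOrbit x y)) (λ x → 𝟙 (minimal x) * orbitSize x) (λ _ → 1)
             points points byX one-minimal-per-orbit)
          (∑-count-const points)
    where
    byX : ∀ x → x ∈ points → ∑ (λ y → 𝟙 (minimal x ∧ inOrbit x y)) points ≡ 𝟙 (minimal x) * orbitSize x
    byX x _ = trans (∑-cong points (λ y _ → 𝟙-∧ (minimal x) (inOrbit x y))) (∑-*ˡ (𝟙 (minimal x)) _ points)

  orbit-counting : ∑ (λ x → 𝟙 (minimal x)) points * length group ≡ length points * S
  orbit-counting = begin
    ∑ (λ x → 𝟙 (minimal x)) points * length group      ≡⟨ sym (∑-*ʳ _ (length group) points) ⟩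
    ∑ (λ x → 𝟙 (minimal x) * length group) points      ≡⟨ ∑-cong points (λ x xm → cong (𝟙 (minimal x) *_)
                                                              (sym (orbit-stabiliser x (sound points-enum xm)))) ⟩
    ∑ (λ x → 𝟙 (minimal x) * (orbitSize x * S)) points ≡⟨ ∑-cong points (λ x _ → sym (*-assoc (𝟙 (minimal x)) (orbitSize x) S)) ⟩
    ∑ (λ x → 𝟙 (minimal x) * orbitSize x * S) points   ≡⟨ ∑-*ʳ _ S points ⟩
    ∑ (λ x → 𝟙 (minimal x) * orbitSize x) points * S   ≡⟨ cong (_* S) ∑-orbitSize-minimal ⟩
    length points * S                                  ∎
    where open ≡-Reasoning

gcd-unique : ∀ {a b g} → g ∣ a → g ∣ b → (∀ {c} → c ∣ a → c ∣ b → c ∣ g) → gcd a b ≡ g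
gcd-unique {a} {b} ga gb h = ∣-antisym (h (gcd[m,n]∣m a b) (gcd[m,n]∣n a b)) (gcd-greatest ga gb)

gcd≡1⁺ : ∀ {a b} → (∀ {c} → c ∣ a → c ∣ b → c ∣ 1) → gcd a b ≡ 1
gcd≡1⁺ h = gcd-unique (1∣ _) (1∣ _) h

gcd≡1⁻ : ∀ {a b c} → gcd a b ≡ 1 → c ∣ a → c ∣ b → c ∣ 1
gcd≡1⁻ e ca cb = subst (_ ∣_) e (gcd-greatest ca cb)

gcd-self : ∀ d → gcd d d ≡ d
gcd-self d = gcd-unique ∣-refl ∣-refl (λ c _ → c)

gcd[m%n,n]≡gcd[m,n] : ∀ m n .{{_ : NonZero n}} → gcd (m % n) n ≡ gcd m n
gcd[m%n,n]≡gcd[m,n] m n = ∣-antisym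
  (gcd-greatest (∣n∣m%n⇒∣m (gcd[m,n]∣n (m % n) n) (gcd[m,n]∣m (m % n) n)) (gcd[m,n]∣n (m % n) n))
  (gcd-greatest (%-presˡ-∣ (gcd[m,n]∣m m n) (gcd[m,n]∣n m n)) (gcd[m,n]∣n m n))

gcd≡1-sym : ∀ {a b} → gcd a b ≡ 1 → gcd b a ≡ 1
gcd≡1-sym {a} {b} h = trans (gcd-comm b a) h

gcd≡1-* : ∀ {a b d} → gcd a d ≡ 1 → gcd b d ≡ 1 → gcd (a * b) d ≡ 1
gcd≡1-* {a} {b} {d} ha hb = gcd≡1⁺ λ {c} cab cd →
  let ca : Coprime c a
      ca = λ (ic , ia) → ∣1⇒≡1 (gcd≡1⁻ {a} {d} ha ia (∣-trans ic cd))
  in gcd≡1⁻ {b} {d} hb (coprime-divisor ca cab) cd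

gcd≡1-∣ : ∀ {a m d} → gcd a m ≡ 1 → d ∣ m → gcd a d ≡ 1
gcd≡1-∣ {a} {m} h dm = gcd≡1⁺ λ ca cd → gcd≡1⁻ {a} {m} h ca (∣-trans cd dm)

gcd≡1-∸ : ∀ {r d} → r ≤ d → gcd r d ≡ 1 → gcd (d ∸ r) d ≡ 1
gcd≡1-∸ {r} {d} r≤d h = gcd≡1⁺ λ {c} c1 c2 → gcd≡1⁻ {r} {d} h (∣m+n∣m⇒∣n (subst (c ∣_) (sym (m∸n+n≡m r≤d)) c2) c1) c2

mod-inverse : ∀ a n .{{_ : NonZero n}} → gcd a n ≡ 1 → ∃ λ b → (b * a) % n ≡ 1 % n
mod-inverse a n h with Bézout.identity (subst (GCD a n) h (gcd-GCD a n))
... | Bézout.Identity.+- x y eq = x , trans (cong (_% n) (sym eq)) ([m+kn]%n≡m%n 1 y n)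
... | Bézout.Identity.-+ x y eq = (n ∸ 1) * x , goal
  where
  open ≡-Reasoning
  t = x * a
  -- from x a + 1 = y n: multiplying by n - 1 gives (n - 1) x a ≡ 1 (mod n)
  goal : ((n ∸ 1) * x * a) % n ≡ 1 % n
  goal = begin
    ((n ∸ 1) * x * a) % n              ≡⟨ cong (_% n) (*-assoc (n ∸ 1) x a) ⟩
    ((n ∸ 1) * t) % n                  ≡⟨ sym ([m+n]%n≡m%n ((n ∸ 1) * t) n) ⟩
    ((n ∸ 1) * t + n) % n              ≡⟨ cong (λ u → ((n ∸ 1) * t + u) % n) (sym (m∸n+n≡m {n} {1} (>-nonZero⁻¹ n))) ⟩
    ((n ∸ 1) * t + ((n ∸ 1) + 1)) % n  ≡⟨ cong (_% n) (sym (+-assoc ((n ∸ 1) * t) (n ∸ 1) 1)) ⟩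
    ((n ∸ 1) * t + (n ∸ 1) + 1) % n    ≡⟨ cong (λ u → ((n ∸ 1) * t + u + 1) % n) (sym (*-identityʳ (n ∸ 1))) ⟩
    ((n ∸ 1) * t + (n ∸ 1) * 1 + 1) % n ≡⟨ cong (λ u → (u + 1) % n) (sym (*-distribˡ-+ (n ∸ 1) t 1)) ⟩
    ((n ∸ 1) * (t + 1) + 1) % n        ≡⟨ cong (λ u → ((n ∸ 1) * u + 1) % n) (trans (+-comm t 1) eq) ⟩
    ((n ∸ 1) * (y * n) + 1) % n        ≡⟨ cong (λ u → (u + 1) % n) (sym (*-assoc (n ∸ 1) y n)) ⟩
    ((n ∸ 1) * y * n + 1) % n          ≡⟨ cong (_% n) (+-comm ((n ∸ 1) * y * n) 1) ⟩
    (1 + (n ∸ 1) * y * n) % n          ≡⟨ [m+kn]%n≡m%n 1 ((n ∸ 1) * y) n ⟩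
    1 % n                              ∎

module Mod (n : ℕ) .{{_ : NonZero n}} where

  +-congˡ : ∀ {a a′} b → a % n ≡ a′ % n → (a + b) % n ≡ (a′ + b) % n
  +-congˡ {a} {a′} b h = trans (%-distribˡ-+ a b n) (trans (cong (λ t → (t + b % n) % n) h) (sym (%-distribˡ-+ a′ b n)))

  +-congʳ : ∀ a {b b′} → b % n ≡ b′ % n → (a + b) % n ≡ (a + b′) % n
  +-congʳ a {b} {b′} h = trans (%-distribˡ-+ a b n) (trans (cong (λ t → (a % n + t) % n) h) (sym (%-distribˡ-+ a b′ n)))

  *-congˡ : ∀ {a a′} b → a % n ≡ a′ % n → (a * b) % n ≡ (a′ * b) % n
  *-congˡ {a} {a′} b h = trans (%-distribˡ-* a b n) (trans (cong (λ t → (t * (b % n)) % n) h) (sym (%-distribˡ-* a′ b n)))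

  *-congʳ : ∀ a {b b′} → b % n ≡ b′ % n → (a * b) % n ≡ (a * b′) % n
  *-congʳ a {b} {b′} h = trans (%-distribˡ-* a b n) (trans (cong (λ t → ((a % n) * t) % n) h) (sym (%-distribˡ-* a b′ n)))

  0%n≡0 : 0 % n ≡ 0
  0%n≡0 = m<n⇒m%n≡m (>-nonZero⁻¹ n)

  +-identityʳ-mod : ∀ a {b} → b % n ≡ 0 → (a + b) % n ≡ a % n
  +-identityʳ-mod a {b} h = trans (+-congʳ a {b} {0} (trans h (sym 0%n≡0))) (cong (_% n) (+-identityʳ a))

  infix 4 _≡±_

  _≡±_ : ℕ → ℕ → Set
  x ≡± y = x % n ≡ y % n ⊎ (x + y) % n ≡ 0

  ≡±-sym : ∀ {x y} → x ≡± y → y ≡± x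
  ≡±-sym (inj₁ h) = inj₁ (sym h)
  ≡±-sym {x} {y} (inj₂ h) = inj₂ (trans (cong (_% n) (+-comm y x)) h)

  ≡±-trans : ∀ {x y z} → x ≡± y → y ≡± z → x ≡± z
  ≡±-trans (inj₁ a) (inj₁ b) = inj₁ (trans a b)
  ≡±-trans {x} {y} {z} (inj₁ a) (inj₂ b) = inj₂ (trans (+-congˡ z a) b)
  ≡±-trans {x} {y} {z} (inj₂ a) (inj₁ b) = inj₂ (trans (+-congʳ x (sym b)) a)
  ≡±-trans {x} {y} {z} (inj₂ a) (inj₂ b) = inj₁ (trans (sym (+-identityʳ-mod x b))
    (trans (cong (_% n) (sym (+-assoc x y z))) (trans (cong (_% n) (+-comm (x + y) z)) (+-identityʳ-mod z a))))

  ≡±-*ˡ : ∀ a {x y} → x ≡± y → a * x ≡± a * y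
  ≡±-*ˡ a (inj₁ h) = inj₁ (*-congʳ a h)
  ≡±-*ˡ a {x} {y} (inj₂ h) = inj₂ (trans (cong (_% n) (sym (*-distribˡ-+ a x y)))
    (trans (*-congʳ a {x + y} {0} (trans h (sym 0%n≡0))) (trans (cong (_% n) (*-zeroʳ a)) 0%n≡0)))

  ≡±-congˡ : ∀ {x x′ y} → x % n ≡ x′ % n → x ≡± y → x′ ≡± y
  ≡±-congˡ h p = ≡±-trans (inj₁ (sym h)) p

  ≡±-congʳ : ∀ {x y y′} → y % n ≡ y′ % n → x ≡± y → x ≡± y′
  ≡±-congʳ h p = ≡±-trans p (inj₁ h)


-- Representatives modulo ± and the sets J_d

if-cases : (b : Bool) (u v : ℕ) → (b ≡ true × (if b then u else v) ≡ u) ⊎ (b ≡ false × (if b then u else v) ≡ v)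
if-cases true u v = inj₁ (refl , refl)
if-cases false u v = inj₂ (refl , refl)

2*≡+ : ∀ r → 2 * r ≡ r + r
2*≡+ r = cong (r +_) (+-identityʳ r)

module Signed (k : ℕ) where

  d : ℕ
  d = suc (suc (suc k))

  open Mod d

  rep-cases : ∀ r → ((2 * r <ᵇ d) ≡ true × rep d r ≡ r) ⊎ ((2 * r <ᵇ d) ≡ false × rep d r ≡ d ∸ r)
  rep-cases r = if-cases (2 * r <ᵇ d) r (d ∸ r)

  2r+2[d∸r]≡d+d : ∀ r → r ≤ d → 2 * r + 2 * (d ∸ r) ≡ d + d
  2r+2[d∸r]≡d+d r r≤d = trans (sym (*-distribˡ-+ 2 r (d ∸ r))) (trans (cong (2 *_) (m+[n∸m]≡n r≤d)) (2*≡+ d))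

  rep-∸ : ∀ r → r ≤ d → rep d r ≡ rep d (d ∸ r)
  rep-∸ r r≤d with rep-cases r | rep-cases (d ∸ r)
  ... | inj₁ (e₁ , q₁) | inj₁ (e₂ , q₂) =
    ⊥-elim (<-irrefl (2r+2[d∸r]≡d+d r r≤d) (+-mono-< (<ᵇ-true⁻ {2 * r} {d} e₁) (<ᵇ-true⁻ {2 * (d ∸ r)} {d} e₂)))
  ... | inj₁ (e₁ , q₁) | inj₂ (e₂ , q₂) = trans q₁ (trans (sym (m∸[m∸n]≡n r≤d)) (sym q₂))
  ... | inj₂ (e₁ , q₁) | inj₁ (e₂ , q₂) = trans q₁ (sym q₂)
  ... | inj₂ (e₁ , q₁) | inj₂ (e₂ , q₂) = trans q₁ (trans d∸r≡r (sym (trans q₂ (m∸[m∸n]≡n r≤d))))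
    where
    2r≤d : 2 * r ≤ d
    2r≤d = ≮⇒≥ (λ lt → <-irrefl (sym (2r+2[d∸r]≡d+d r r≤d)) (+-mono-<-≤ lt (<ᵇ-false⁻ e₂)))
    d∸r≡r : d ∸ r ≡ r
    d∸r≡r = trans (cong (_∸ r) (sym (trans (sym (2*≡+ r)) (≤-antisym 2r≤d (<ᵇ-false⁻ e₁))))) (m+n∸n≡m r r)

  rep≡± : ∀ x → rep d (x % d) ≡± x
  rep≡± x with rep-cases (x % d)
  ... | inj₁ (_ , q) = inj₁ (trans (cong (_% d) q) (m%n%n≡m%n x d))
  ... | inj₂ (_ , q) = inj₂ (trans (cong (λ t → (t + x) % d) q)
         (trans (+-congʳ (d ∸ x % d) {x} {x % d} (sym (m%n%n≡m%n x d)))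
           (trans (cong (_% d) (m∸n+n≡m (m%n≤n x d))) (n%n≡0 d))))

  rep-cong : ∀ {x y} → x ≡± y → rep d (x % d) ≡ rep d (y % d)
  rep-cong (inj₁ h) = cong (rep d) h
  rep-cong {x} {y} (inj₂ h) with m%n≡0⇒n∣m (x % d + y % d) d (trans (sym (%-distribˡ-+ x y d)) h)
  ... | divides zero eq = trans (cong (rep d) (m+n≡0⇒m≡0 (x % d) eq)) (sym (cong (rep d) (m+n≡0⇒n≡0 (x % d) eq)))
  ... | divides (suc zero) eq = trans (rep-∸ (x % d) (m%n≤n x d)) (cong (rep d) (sym y%d≡d∸x%d))
    where
    y%d≡d∸x%d : y % d ≡ d ∸ x % d
    y%d≡d∸x%d = trans (sym (m+n∸m≡n (x % d) (y % d))) (cong (_∸ x % d) (trans eq (+-identityʳ d)))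
  ... | divides (suc (suc q)) eq = ⊥-elim (<-irrefl eq (<-≤-trans (+-mono-< (m%n<n x d) (m%n<n y d))
          (+-monoʳ-≤ d (m≤m+n d (q * d)))))

  rep-injective : ∀ {x y} → rep d (x % d) ≡ rep d (y % d) → x ≡± y
  rep-injective {x} {y} h = ≡±-trans {x} {rep d (x % d)} {y} (≡±-sym {rep d (x % d)} {x} (rep≡± x)) (subst (λ t → t ≡± y) (sym h) (rep≡± y))

  inJ : ℕ → Bool
  inJ j = ((1 ≤ᵇ j) ∧ ((2 * j) <ᵇ d) ∧ coprimeᵇ j d) ∧ (j <ᵇ d)

  inJ⁻ : ∀ {j} → inJ j ≡ true → (1 ≤ j) × (2 * j < d) × (gcd j d ≡ 1) × (j < d)
  inJ⁻ {j} h with ∧-true⁻ {(1 ≤ᵇ j) ∧ ((2 * j) <ᵇ d) ∧ coprimeᵇ j d} h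
  ... | h₁ , h₂ with ∧-true⁻ {1 ≤ᵇ j} h₁
  ... | h₃ , h₄ with ∧-true⁻ {(2 * j) <ᵇ d} h₄
  ... | h₅ , h₆ = ≤ᵇ-true⁻ h₃ , <ᵇ-true⁻ h₅ , ≡ᵇ-true⁻ h₆ , <ᵇ-true⁻ h₂

  inJ⁺ : ∀ {j} → 1 ≤ j → 2 * j < d → gcd j d ≡ 1 → j < d → inJ j ≡ true
  inJ⁺ a b c e = ∧-true⁺ (∧-true⁺ (≤ᵇ-true⁺ a) (∧-true⁺ (<ᵇ-true⁺ b) (≡ᵇ-true⁺ c))) (<ᵇ-true⁺ e)

  rep-J : ∀ {j} → inJ j ≡ true → rep d (j % d) ≡ j
  rep-J {j} h with inJ⁻ {j} h
  ... | _ , 2j<d , _ , j<d with rep-cases j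
  ... | inj₁ (_ , q) = trans (cong (rep d) (m<n⇒m%n≡m j<d)) q
  ... | inj₂ (e , _) = ⊥-elim (true≢false (trans (sym (<ᵇ-true⁺ {2 * j} {d} 2j<d)) e))

  -- A unit r with 2r = d would divide 2, but d ≥ 3.
  2*unit≢d : ∀ {r} → gcd r d ≡ 1 → 2 * r ≢ d
  2*unit≢d {r} g e = d≢2 (trans (sym e) (cong (2 *_) (∣1⇒≡1 (subst (r ∣_) g (gcd-greatest ∣-refl (divides 2 (sym e)))))))
    where
    d≢2 : d ≢ 2
    d≢2 ()

  unit≢0 : ∀ {r} → gcd r d ≡ 1 → r ≢ 0
  unit≢0 g refl = true≢false (trans (sym (≡ᵇ-true⁺ g)) refl)

  rep-unit-∈J : ∀ {r} → r < d → gcd r d ≡ 1 → inJ (rep d r) ≡ true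
  rep-unit-∈J {r} r<d gr with rep-cases r
  ... | inj₁ (e , q) rewrite q = inJ⁺ (n≢0⇒n>0 (unit≢0 gr)) (<ᵇ-true⁻ e) gr r<d
  ... | inj₂ (e , q) rewrite q = inJ⁺ (n≢0⇒n>0 (m>n⇒m∸n≢0 r<d)) 2[d∸r]<d (gcd≡1-∸ (<⇒≤ r<d) gr) d∸r<d
    where
    d<2r : d < 2 * r
    d<2r = ≤∧≢⇒< (<ᵇ-false⁻ {2 * r} {d} e) (λ x → 2*unit≢d {r} gr (sym x))
    2[d∸r]<d : 2 * (d ∸ r) < d
    2[d∸r]<d = ≰⇒> λ ge → <-irrefl (sym (2r+2[d∸r]≡d+d r (<⇒≤ r<d))) (+-mono-<-≤ d<2r ge)
    d∸r<d : d ∸ r < d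
    d∸r<d = subst (d ∸ r <_) (m∸n+n≡m (<⇒≤ r<d)) (m<m+n (d ∸ r) (n≢0⇒n>0 (unit≢0 gr)))

  actJ-1 : ∀ {j} → inJ j ≡ true → rep d ((1 * j) % d) ≡ j
  actJ-1 {j} h = trans (cong (λ t → rep d (t % d)) (*-identityˡ j)) (rep-J h)

  actJ-closed : ∀ a {j} → inJ j ≡ true → gcd a d ≡ 1 → inJ (rep d ((a * j) % d)) ≡ true
  actJ-closed a {j} h ha with inJ⁻ {j} h
  ... | _ , _ , gj , _ = rep-unit-∈J (m%n<n (a * j) d) (trans (gcd[m%n,n]≡gcd[m,n] (a * j) d) (gcd≡1-* {a} {j} {d} ha gj))

  actJ-* : ∀ a b j → rep d ((a * rep d ((b * j) % d)) % d) ≡ rep d (((a * b) * j) % d)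
  actJ-* a b j = rep-cong {a * rep d ((b * j) % d)} {(a * b) * j} (≡±-congʳ {a * rep d ((b * j) % d)} {a * (b * j)} {(a * b) * j}
    (cong (_% d) (sym (*-assoc a b j))) (≡±-*ˡ a {rep d ((b * j) % d)} {b * j} (rep≡± (b * j))))

  actJ-cong : ∀ {a a′} j → a % d ≡ a′ % d → rep d ((a * j) % d) ≡ rep d ((a′ * j) % d)
  actJ-cong {a} {a′} j h = rep-cong {a * j} {a′ * j} (inj₁ (*-congˡ {a} {a′} j h))

  -- Cancelling the unit j (by its inverse j′ mod d): b j ≡ ± j  iff  b ≡ ± 1.
  actJ-fixes : ∀ b {j} → inJ j ≡ true → eqb _≟_ (rep d ((b * j) % d)) j ≡ eqb _≟_ (rep d (b % d)) 1
  actJ-fixes b {j} h with inJ⁻ {j} h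
  ... | _ , _ , gj , _ with mod-inverse j d gj
  ... | j′ , j′j≡1 = eqb-cong _≟_ _≟_ fwd bwd
    where
    fwd : rep d ((b * j) % d) ≡ j → rep d (b % d) ≡ 1
    fwd e = rep-cong {b} {1} (≡±-congʳ {b} {j′ * j} {1} j′j≡1 (≡±-congˡ {j′ * (b * j)} {b} {j′ * j} j′bj≡b
              (≡±-*ˡ j′ {b * j} {j} (rep-injective {b * j} {j} (trans e (sym (rep-J h)))))))
      where
      j′bj≡b : (j′ * (b * j)) % d ≡ b % d
      j′bj≡b = trans (cong (_% d) (trans (sym (*-assoc j′ b j)) (trans (cong (_* j) (*-comm j′ b)) (*-assoc b j′ j))))
                     (trans (*-congʳ b {j′ * j} {1} j′j≡1) (cong (_% d) (*-identityʳ b)))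
    bwd : rep d (b % d) ≡ 1 → rep d ((b * j) % d) ≡ j
    bwd e = trans (rep-cong {b * j} {j} (subst₂ (λ u v → u ≡± v) (*-comm j b) (*-identityʳ j)
                    (≡±-*ˡ j {b} {1} (rep-injective {b} {1} e)))) (rep-J h)

memJ : ℕ → ℕ → Bool
memJ d = if d ≤ᵇ 2 then (λ z → eqb _≟_ z 1) else (λ z → ((1 ≤ᵇ z) ∧ ((2 * z) <ᵇ d) ∧ coprimeᵇ z d) ∧ (z <ᵇ d))

J-enumerates : ∀ d → Enumerates _≟_ (memJ d) (J d)
J-enumerates zero = singleton-enumerates 1
J-enumerates (suc zero) = singleton-enumerates 1
J-enumerates (suc (suc zero)) = singleton-enumerates 1
J-enumerates (suc (suc (suc k))) = filterᵇ-enumerates (upTo-enumerates (suc (suc (suc k)))) _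

actJ : ℕ → ℕ → ℕ → ℕ
actJ d a j = rep d (modN (a * j) d)

actJ-* : ∀ d a b j → actJ d a (actJ d b j) ≡ actJ d (a * b) j
actJ-* zero a b j = refl
actJ-* (suc zero) a b j = refl
actJ-* (suc (suc zero)) a b j = refl
actJ-* (suc (suc (suc k))) a b j = Signed.actJ-* k a b j

actJ-cong : ∀ d {a a′} j → modN a d ≡ modN a′ d → actJ d a j ≡ actJ d a′ j
actJ-cong zero j h = refl
actJ-cong (suc zero) j h = refl
actJ-cong (suc (suc zero)) j h = refl
actJ-cong (suc (suc (suc k))) {a} {a′} j h = Signed.actJ-cong k {a} {a′} j h

actJ-1 : ∀ d j → memJ d j ≡ true → actJ d 1 j ≡ j
actJ-1 zero j h = sym (eqb-true⁻ _≟_ h)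
actJ-1 (suc zero) j h = sym (eqb-true⁻ _≟_ h)
actJ-1 (suc (suc zero)) j h = sym (eqb-true⁻ _≟_ h)
actJ-1 (suc (suc (suc k))) j h = Signed.actJ-1 k h

actJ-closed : ∀ d a j → memJ d j ≡ true → gcd a d ≡ 1 → memJ d (actJ d a j) ≡ true
actJ-closed zero a j h ha = refl
actJ-closed (suc zero) a j h ha = refl
actJ-closed (suc (suc zero)) a j h ha = refl
actJ-closed (suc (suc (suc k))) a j h ha = Signed.actJ-closed k a h ha

actJ-fixes : ∀ d b j → memJ d j ≡ true → eqb _≟_ (actJ d b j) j ≡ eqb _≟_ (rep d (modN b d)) 1
actJ-fixes zero b j h with eqb-true⁻ _≟_ {j} {1} h
... | refl = refl
actJ-fixes (suc zero) b j h with eqb-true⁻ _≟_ {j} {1} h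
... | refl = refl
actJ-fixes (suc (suc zero)) b j h with eqb-true⁻ _≟_ {j} {1} h
... | refl = refl
actJ-fixes (suc (suc (suc k))) b j h = Signed.actJ-fixes k b h

lex-< : ∀ {x y} xs ys → x < y → lex≤ (x ∷ xs) (y ∷ ys) ≡ true
lex-< {x} {y} xs ys h rewrite <ᵇ-true⁺ h = refl

lex-≡ : ∀ x xs ys → lex≤ (x ∷ xs) (x ∷ ys) ≡ lex≤ xs ys
lex-≡ x xs ys rewrite <ᵇ-false⁺ {x} {x} ≤-refl | ≡ᵇ-true⁺ {x} {x} refl = refl

lex-> : ∀ {x y} xs ys → y < x → lex≤ (x ∷ xs) (y ∷ ys) ≡ false
lex-> {x} {y} xs ys h with x ≡ᵇ y in e
... | true = ⊥-elim (<-irrefl (sym (≡ᵇ-true⁻ e)) h)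
... | false rewrite <ᵇ-false⁺ {x} {y} (<⇒≤ h) = refl

lex-∷⁻ : ∀ {x y} xs ys → lex≤ (x ∷ xs) (y ∷ ys) ≡ true → x < y ⊎ (x ≡ y × lex≤ xs ys ≡ true)
lex-∷⁻ {x} {y} xs ys h with <-cmp x y
... | tri< lt _ _ = inj₁ lt
... | tri≈ _ refl _ = inj₂ (refl , trans (sym (lex-≡ x xs ys)) h)
... | tri> _ _ gt = ⊥-elim (true≢false (trans (sym h) (lex-> xs ys gt)))

lex-total : ∀ xs ys → lex≤ xs ys ≡ true ⊎ lex≤ ys xs ≡ true
lex-total [] ys = inj₁ refl
lex-total (x ∷ xs) [] = inj₂ refl
lex-total (x ∷ xs) (y ∷ ys) with <-cmp x y
... | tri< lt _ _ = inj₁ (lex-< xs ys lt)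
... | tri> _ _ gt = inj₂ (lex-< ys xs gt)
... | tri≈ _ refl _ with lex-total xs ys
...   | inj₁ h = inj₁ (trans (lex-≡ x xs ys) h)
...   | inj₂ h = inj₂ (trans (lex-≡ x ys xs) h)

lex-antisym : ∀ {xs ys} → lex≤ xs ys ≡ true → lex≤ ys xs ≡ true → xs ≡ ys
lex-antisym {[]} {[]} h₁ h₂ = refl
lex-antisym {x ∷ xs} {y ∷ ys} h₁ h₂ with lex-∷⁻ {x} {y} xs ys h₁ | lex-∷⁻ {y} {x} ys xs h₂
... | inj₁ lt | inj₁ gt = ⊥-elim (<-asym lt gt)
... | inj₁ lt | inj₂ (e , _) = ⊥-elim (<-irrefl (sym e) lt)
... | inj₂ (e , _) | inj₁ gt = ⊥-elim (<-irrefl (sym e) gt)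
... | inj₂ (refl , a) | inj₂ (_ , b) = cong (x ∷_) (lex-antisym a b)

lex-trans : ∀ {xs ys zs} → lex≤ xs ys ≡ true → lex≤ ys zs ≡ true → lex≤ xs zs ≡ true
lex-trans {[]} h₁ h₂ = refl
lex-trans {x ∷ xs} {y ∷ ys} {z ∷ zs} h₁ h₂ with lex-∷⁻ {x} {y} xs ys h₁ | lex-∷⁻ {y} {z} ys zs h₂
... | inj₁ a | inj₁ b = lex-< xs zs (<-trans a b)
... | inj₁ a | inj₂ (refl , _) = lex-< xs zs a
... | inj₂ (refl , _) | inj₁ b = lex-< xs zs b
... | inj₂ (refl , a) | inj₂ (refl , b) = trans (lex-≡ x xs zs) (lex-trans {xs} {ys} {zs} a b)

memTuples : List ℕ → List ℕ → Bool
memTuples [] = nilMem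
memTuples (d ∷ ds) = consMem (memJ d) (memTuples ds)

tuples-enumerates : ∀ ds → Enumerates (≡-dec _≟_) (memTuples ds) (tuples ds)
tuples-enumerates [] = nil-enumerates _≟_
tuples-enumerates (d ∷ ds) = prepend-enumerates (J-enumerates d) (tuples-enumerates ds)

length-tuples : ∀ ds → length (tuples ds) ≡ product (map (λ d → length (J d)) ds)
length-tuples [] = refl
length-tuples (d ∷ ds) = trans (length-prepend (J d) (tuples ds)) (cong (length (J d) *_) (length-tuples ds))

act-* : ∀ ds a b x → act ds a (act ds b x) ≡ act ds (a * b) x
act-* [] a b x = refl
act-* (d ∷ ds) a b [] = refl
act-* (d ∷ ds) a b (j ∷ x) = cong₂ _∷_ (actJ-* d a b j) (act-* ds a b x)

act-cong : ∀ ds {a a′} x → (∀ d → d ∈ ds → modN a d ≡ modN a′ d) → act ds a x ≡ act ds a′ x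
act-cong [] x h = refl
act-cong (d ∷ ds) [] h = refl
act-cong (d ∷ ds) {a} {a′} (j ∷ x) h = cong₂ _∷_ (actJ-cong d {a} {a′} j (h d (here refl))) (act-cong ds x (λ d′ m → h d′ (there m)))

act-1 : ∀ ds x → memTuples ds x ≡ true → act ds 1 x ≡ x
act-1 [] [] h = refl
act-1 (d ∷ ds) (j ∷ x) h = let a , b = ∧-true⁻ {memJ d j} h in cong₂ _∷_ (actJ-1 d j a) (act-1 ds x b)

act-closed : ∀ ds a x → memTuples ds x ≡ true → (∀ d → d ∈ ds → gcd a d ≡ 1) → memTuples ds (act ds a x) ≡ true
act-closed [] a [] h g = refl
act-closed (d ∷ ds) a (j ∷ x) h g = let u , v = ∧-true⁻ {memJ d j} h in
  ∧-true⁺ (actJ-closed d a j u (g d (here refl))) (act-closed ds a x v (λ d′ m → g d′ (there m)))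

-- rep d (b mod d) ≡ 1 says that b ≡ ±1 (mod d).
fixesAll : List ℕ → ℕ → Bool
fixesAll [] b = true
fixesAll (d ∷ ds) b = eqb _≟_ (rep d (modN b d)) 1 ∧ fixesAll ds b

act-fixes : ∀ ds b x → memTuples ds x ≡ true → eqb (≡-dec _≟_) (act ds b x) x ≡ fixesAll ds b
act-fixes [] b [] h = refl
act-fixes (d ∷ ds) b (j ∷ x) h = let u , v = ∧-true⁻ {memJ d j} h in
  cong₂ _∧_ (actJ-fixes d b j u) (act-fixes ds b x v)

fixesAll⁻ : ∀ ds b → fixesAll ds b ≡ true → ∀ d → d ∈ ds → rep d (modN b d) ≡ 1
fixesAll⁻ (e ∷ ds) b h d (here refl) = eqb-true⁻ _≟_ (proj₁ (∧-true⁻ h))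
fixesAll⁻ (e ∷ ds) b h d (there m) = fixesAll⁻ ds b (proj₂ (∧-true⁻ {eqb _≟_ (rep e (modN b e)) 1} h)) d m

fixesAll⁺ : ∀ ds b → (∀ d → d ∈ ds → rep d (modN b d) ≡ 1) → fixesAll ds b ≡ true
fixesAll⁺ [] b h = refl
fixesAll⁺ (e ∷ ds) b h = ∧-true⁺ (eqb-true⁺ _≟_ (h e (here refl))) (fixesAll⁺ ds b (λ d m → h d (there m)))

lcm≢0 : ∀ m n → m ≢ 0 → n ≢ 0 → lcm m n ≢ 0
lcm≢0 m n m≢0 n≢0 e with m*n≡0⇒m≡0∨n≡0 m (trans (sym (gcd*lcm m n)) (trans (cong (gcd m n *_) e) (*-zeroʳ (gcd m n))))
... | inj₁ x = m≢0 x
... | inj₂ x = n≢0 x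

lcmList≢0 : ∀ ds → (∀ d → d ∈ ds → d ≢ 0) → lcmList ds ≢ 0
lcmList≢0 [] h ()
lcmList≢0 (d ∷ ds) h = lcm≢0 d (lcmList ds) (h d (here refl)) (lcmList≢0 ds (λ e m → h e (there m)))

∈⇒∣lcmList : ∀ {d} ds → d ∈ ds → d ∣ lcmList ds
∈⇒∣lcmList (e ∷ ds) (here refl) = m∣lcm[m,n] e (lcmList ds)
∈⇒∣lcmList (e ∷ ds) (there m) = ∣-trans (∈⇒∣lcmList ds m) (n∣lcm[m,n] e (lcmList ds))

lcmList-least : ∀ {c} ds → (∀ d → d ∈ ds → d ∣ c) → lcmList ds ∣ c
lcmList-least {c} [] h = 1∣ c
lcmList-least (e ∷ ds) h = lcm-least (h e (here refl)) (lcmList-least ds (λ d m → h d (there m)))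

∈⇒∣product : ∀ {d} ds → d ∈ ds → d ∣ product ds
∈⇒∣product (e ∷ ds) (here refl) = m∣m*n (product ds)
∈⇒∣product (e ∷ ds) (there m) = ∣n⇒∣m*n e (∈⇒∣product ds m)

product≢0 : ∀ ds → (∀ d → d ∈ ds → d ≢ 0) → product ds ≢ 0
product≢0 [] h ()
product≢0 (d ∷ ds) h e with m*n≡0⇒m≡0∨n≡0 d e
... | inj₁ x = h d (here refl) x
... | inj₂ x = product≢0 ds (λ d′ m → h d′ (there m)) x

gcd≡1-product : ∀ {a} ds → (∀ d → d ∈ ds → gcd a d ≡ 1) → gcd a (product ds) ≡ 1
gcd≡1-product {a} [] h = gcd-zeroʳ a
gcd≡1-product {a} (d ∷ ds) h = gcd≡1-sym {d * product ds} {a}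
  (gcd≡1-* {d} {product ds} {a} (gcd≡1-sym {a} {d} (h d (here refl))) (gcd≡1-sym {a} {product ds} (gcd≡1-product {a} ds (λ e m → h e (there m)))))

modN-% : ∀ d n .{{_ : NonZero n}} → d ∣ n → ∀ a → modN (a % n) d ≡ modN a d
modN-% zero n h a = refl
modN-% (suc k) n h a = m∣n⇒o%n%m≡o%m (suc k) n a h

module UnitAction (ds : List ℕ) (pos : All (1 ≤_) ds) where

  L N : ℕ
  L = lcmList ds
  N = product ds

  ds≢0 : ∀ d → d ∈ ds → d ≢ 0
  ds≢0 d m e = <-irrefl (sym e) (All.lookup pos m)

  L≢0 : L ≢ 0
  L≢0 = lcmList≢0 ds ds≢0

  instance
    L-nonZero : NonZero L
    L-nonZero = ≢-nonZero L≢0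

  d∣L : ∀ d → d ∈ ds → d ∣ L
  d∣L d = ∈⇒∣lcmList ds

  L∣N : L ∣ N
  L∣N = lcmList-least ds (λ d → ∈⇒∣product ds)

  L≤N : L ≤ N
  L≤N = ∣⇒≤ {{≢-nonZero (product≢0 ds ds≢0)}} L∣N

  modN-cong : ∀ {u v} → u % L ≡ v % L → ∀ d → d ∈ ds → modN u d ≡ modN v d
  modN-cong {u} {v} h d m = trans (sym (modN-% d L (d∣L d m) u)) (trans (cong (λ t → modN t d) h) (modN-% d L (d∣L d m) v))

  gcd≡1-ds : ∀ {a} → gcd a L ≡ 1 → ∀ d → d ∈ ds → gcd a d ≡ 1
  gcd≡1-ds {a} h d m = gcd≡1-∣ {a} {L} {d} h (d∣L d m)

  isUnit : ℕ → Bool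
  isUnit a = coprimeᵇ a L ∧ (a <ᵇ L)

  units-enumerates : ∀ n → Enumerates _≟_ (λ a → coprimeᵇ a n ∧ (a <ᵇ n)) (units n)
  units-enumerates n = filterᵇ-enumerates (upTo-enumerates n) (λ a → coprimeᵇ a n)

  isUnit⁻ : ∀ {a} → isUnit a ≡ true → gcd a L ≡ 1 × a < L
  isUnit⁻ {a} h = let u , v = ∧-true⁻ {coprimeᵇ a L} h in ≡ᵇ-true⁻ u , <ᵇ-true⁻ v

  isUnit⁺ : ∀ {a} → gcd a L ≡ 1 → a < L → isUnit a ≡ true
  isUnit⁺ g l = ∧-true⁺ (≡ᵇ-true⁺ g) (<ᵇ-true⁺ l)

  isUnit-% : ∀ {a} → gcd a L ≡ 1 → isUnit (a % L) ≡ true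
  isUnit-% {a} g = isUnit⁺ (trans (gcd[m%n,n]≡gcd[m,n] a L) g) (m%n<n a L)

  inv : ℕ → ℕ
  inv a with gcd a L ≟ 1
  ... | yes h = proj₁ (mod-inverse a L h) % L
  ... | no _ = 0

  inv-* : ∀ a → gcd a L ≡ 1 → (inv a * a) % L ≡ 1 % L
  inv-* a h with gcd a L ≟ 1
  ... | yes h′ = trans (Mod.*-congˡ L a (m%n%n≡m%n _ L)) (proj₂ (mod-inverse a L h′))
  ... | no ne = ⊥-elim (ne h)

  *-inv : ∀ a → gcd a L ≡ 1 → (a * inv a) % L ≡ 1 % L
  *-inv a h = trans (cong (_% L) (*-comm a (inv a))) (inv-* a h)

  isUnit-inv : ∀ {a} → isUnit a ≡ true → isUnit (inv a) ≡ true
  isUnit-inv {a} ha = isUnit⁺ (gcd≡1⁺ {inv a} {L} λ {c} ci cL →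
      ∣n∣m%n⇒∣m {n = L} {m = 1} cL (subst (c ∣_) (inv-* a g) (%-presˡ-∣ {n = L} {m = inv a * a} (∣m⇒∣m*n a ci) cL)))
    inv<L
    where
    g = proj₁ (isUnit⁻ {a} ha)
    inv<L : inv a < L
    inv<L with gcd a L ≟ 1
    ... | yes _ = m%n<n _ L
    ... | no _ = n≢0⇒n>0 L≢0

  _∙_ : ℕ → ℕ → ℕ
  a ∙ b = (a * b) % L

  cancel : ∀ {a b c} → (a * b) % L ≡ 1 % L → c < L → (a * ((b * c) % L)) % L ≡ c
  cancel {a} {b} {c} ab≡1 c<L =
    trans (Mod.*-congʳ L a (m%n%n≡m%n (b * c) L))
     (trans (cong (_% L) (sym (*-assoc a b c)))
      (trans (Mod.*-congˡ L c ab≡1)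
       (trans (cong (_% L) (*-identityˡ c)) (m<n⇒m%n≡m c<L))))

  act-% : ∀ a x → act ds (a % L) x ≡ act ds a x
  act-% a x = act-cong ds x (modN-cong (m%n%n≡m%n a L))

  act-inv : ∀ {a} → isUnit a ≡ true → ∀ x → memTuples ds x ≡ true → act ds (inv a) (act ds a x) ≡ x
  act-inv {a} ha x hx = trans (act-* ds (inv a) a x)
    (trans (act-cong ds x (modN-cong (inv-* a (proj₁ (isUnit⁻ {a} ha))))) (act-1 ds x hx))

  act-inv′ : ∀ {a} → isUnit a ≡ true → ∀ x → memTuples ds x ≡ true → act ds a (act ds (inv a) x) ≡ x
  act-inv′ {a} ha x hx = trans (act-* ds a (inv a) x)
    (trans (act-cong ds x (modN-cong (*-inv a (proj₁ (isUnit⁻ {a} ha))))) (act-1 ds x hx))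

  -- The test made by orb; units mod N act through their residues mod L, so it is minimality under (ℤ/Lℤ)^×.
  minimal : List ℕ → Bool
  minimal x = all (λ a → lex≤ x (act ds a x)) (units N)

  minimal-sound : ∀ x → minimal x ≡ true → ∀ a → isUnit a ≡ true → lex≤ x (act ds a x) ≡ true
  minimal-sound x hm a ha = all-true⁻ _ (units N) hm a∈units-N
    where
    g = proj₁ (isUnit⁻ {a} ha)
    a∈units-N : a ∈ units N
    a∈units-N = complete (units-enumerates N)
      (∧-true⁺ (≡ᵇ-true⁺ (gcd≡1-product {a} ds (gcd≡1-ds {a} g))) (<ᵇ-true⁺ (<-≤-trans (proj₂ (isUnit⁻ {a} ha)) L≤N)))

  minimal-complete : ∀ x → (∀ b → isUnit b ≡ true → lex≤ x (act ds b x) ≡ true) → minimal x ≡ true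
  minimal-complete x h = all-true⁺ _ (units N) λ {a} am →
    let g = ≡ᵇ-true⁻ (proj₁ (∧-true⁻ (sound (units-enumerates N) am)))
    in subst (λ t → lex≤ x t ≡ true) (act-% a x) (h (a % L) (isUnit-% {a} (gcd≡1-∣ {a} {N} {L} g L∣N)))

  action : FiniteAction ℕ (List ℕ)
  action = record
    { _≟ᴳ_ = _≟_
    ; _≟ˣ_ = ≡-dec _≟_
    ; group = units L
    ; memG = isUnit
    ; group-enum = units-enumerates L
    ; points = tuples ds
    ; memX = memTuples ds
    ; points-enum = tuples-enumerates ds
    ; _·_ = act ds
    ; _∙_ = _∙_
    ; _⁻¹ = inv
    ; ε = 1 % L
    ; ·-closed = λ {a} {x} ha hx → act-closed ds a x hx (gcd≡1-ds {a} (proj₁ (isUnit⁻ {a} ha)))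
    ; ∙-closed = λ {a} {b} ha hb → isUnit-% {a * b} (gcd≡1-* {a} {b} {L} (proj₁ (isUnit⁻ {a} ha)) (proj₁ (isUnit⁻ {b} hb)))
    ; ⁻¹-closed = λ {a} → isUnit-inv {a}
    ; ε-closed = isUnit-% {1} (gcd-zeroˡ L)
    ; ·-∙ = λ {a} {b} {x} _ _ _ → trans (act-% (a * b) x) (sym (act-* ds a b x))
    ; ·-ε = λ {x} hx → trans (act-% 1 x) (act-1 ds x hx)
    ; ⁻¹-·-cancel = λ {a} {x} ha hx → act-inv {a} ha x hx
    ; ·-⁻¹-cancel = λ {a} {x} ha hx → act-inv′ {a} ha x hx
    ; ∙-⁻¹-cancel = λ {a} {b} ha hb → cancel {a} {inv a} {b} (*-inv a (proj₁ (isUnit⁻ {a} ha))) (proj₂ (isUnit⁻ {b} hb))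
    ; ⁻¹-∙-cancel = λ {a} {b} ha hb → cancel {inv a} {a} {b} (inv-* a (proj₁ (isUnit⁻ {a} ha))) (proj₂ (isUnit⁻ {b} hb))
    ; _≤ˣ_ = lex≤
    ; ≤ˣ-total = lex-total
    ; ≤ˣ-antisym = lex-antisym
    ; ≤ˣ-trans = λ {x} {y} {z} → lex-trans {x} {y} {z}
    ; minimal = minimal
    ; minimal-sound = λ {x} _ → minimal-sound x
    ; minimal-complete = λ {x} _ → minimal-complete x
    ; stabiliser-size = ∑ (λ b → 𝟙 (fixesAll ds b)) (units L)
    ; stabiliser = λ x hx → ∑-cong (units L) (λ b _ → cong 𝟙 (act-fixes ds b x hx))
    }

  orb*|units| : orb ds * length (units L) ≡ length (tuples ds) * ∑ (λ b → 𝟙 (fixesAll ds b)) (units L)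
  orb*|units| = trans (cong (_* length (units L)) (countᵇ≡∑ minimal (tuples ds))) (OrbitCounting.orbit-counting action)

-- Euler's function, and |J_d| = φ̃(d)

∑-upTo-suc : ∀ (f : ℕ → ℕ) n → ∑ f (upTo (suc n)) ≡ f 0 + ∑ (λ a → f (suc a)) (upTo n)
∑-upTo-suc f n = cong (f 0 +_) (trans (cong (∑ f) (sym (map-upTo suc n))) (∑-map f suc (upTo n)))

∑-upTo-∷ʳ : ∀ (f : ℕ → ℕ) n → ∑ f (upTo (suc n)) ≡ ∑ f (upTo n) + f n
∑-upTo-∷ʳ f n = trans (cong (∑ f) (sym (upTo-∷ʳ n))) (trans (∑-++ f (upTo n) [ n ]) (cong (∑ f (upTo n) +_) (+-identityʳ (f n))))

∑-upTo-rotate : ∀ (f : ℕ → ℕ) n → f 0 ≡ f n → ∑ (λ a → f (suc a)) (upTo n) ≡ ∑ f (upTo n)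
∑-upTo-rotate f zero h = refl
∑-upTo-rotate f (suc n) h = trans (∑-upTo-∷ʳ (λ a → f (suc a)) n)
  (trans (cong (∑ (λ a → f (suc a)) (upTo n) +_) (sym h)) (trans (+-comm _ (f 0)) (sym (∑-upTo-suc f n))))

-- φ counts 1 ≤ j ≤ d, the sums below count 0 ≤ a < d; gcd(0, d) = gcd(d, d).
φ≡∑coprime : ∀ d → φ d ≡ ∑ (λ a → 𝟙 (coprimeᵇ a d)) (upTo d)
φ≡∑coprime d = trans (countᵇ≡∑ _ (upTo d))
  (∑-upTo-rotate (λ a → 𝟙 (coprimeᵇ a d)) d (cong (λ t → 𝟙 (t ≡ᵇ 1)) (trans (gcd-identityˡ d) (sym (gcd-self d)))))

length-units : ∀ n → length (units n) ≡ φ n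
length-units n = trans (countᵇ≡∑ _ (upTo n)) (sym (φ≡∑coprime n))

𝟙-split : ∀ p c → 𝟙 c ≡ 𝟙 (p ∧ c) + 𝟙 (not p ∧ c)
𝟙-split true c = sym (+-identityʳ (𝟙 c))
𝟙-split false c = refl

-- The units below d/2 form J_d, and a ↦ d - a maps the units above d/2 onto J_d.
module Halves (k : ℕ) where
  open Signed k using (d; inJ; inJ⁻; inJ⁺; 2r+2[d∸r]≡d+d; 2*unit≢d; unit≢0)

  lower upper : ℕ → Bool
  lower a = ((2 * a) <ᵇ d) ∧ coprimeᵇ a d
  upper a = not ((2 * a) <ᵇ d) ∧ coprimeᵇ a d

  #lower≡|J| : ∑ (λ a → 𝟙 (lower a)) (upTo d) ≡ length (J d)
  #lower≡|J| = trans (∑-cong (upTo d) (λ a _ → lower≗J a)) (sym (countᵇ≡∑ (λ a → (1 ≤ᵇ a) ∧ ((2 * a) <ᵇ d) ∧ coprimeᵇ a d) (upTo d)))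
    where
    lower≗J : ∀ a → 𝟙 (lower a) ≡ 𝟙 ((1 ≤ᵇ a) ∧ ((2 * a) <ᵇ d) ∧ coprimeᵇ a d)
    lower≗J zero = refl
    lower≗J (suc a) = refl

  upper⁻ : ∀ {a} → upper a ≡ true → d ≤ 2 * a × gcd a d ≡ 1
  upper⁻ {a} h = let u , v = ∧-true⁻ {not ((2 * a) <ᵇ d)} h in <ᵇ-false⁻ {2 * a} {d} (not-true⁻ u) , ≡ᵇ-true⁻ v

  upper⁺ : ∀ {a} → d ≤ 2 * a → gcd a d ≡ 1 → upper a ≡ true
  upper⁺ {a} le g = ∧-true⁺ (not-true⁺ (<ᵇ-false⁺ {2 * a} {d} le)) (≡ᵇ-true⁺ g)

  2[d∸a]<d : ∀ {a} → a ≤ d → d < 2 * a → 2 * (d ∸ a) < d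
  2[d∸a]<d {a} a≤d lt = ≰⇒> λ ge → <-irrefl (sym (2r+2[d∸r]≡d+d a a≤d)) (+-mono-<-≤ lt ge)

  d≤2[d∸a] : ∀ {a} → a ≤ d → 2 * a < d → d ≤ 2 * (d ∸ a)
  d≤2[d∸a] {a} a≤d lt = ≮⇒≥ λ gt → <-irrefl (2r+2[d∸r]≡d+d a a≤d) (+-mono-< lt gt)

  d∸a<d : ∀ {a} → a < d → gcd a d ≡ 1 → d ∸ a < d
  d∸a<d {a} a<d g = subst (d ∸ a <_) (m∸n+n≡m (<⇒≤ a<d)) (m<m+n (d ∸ a) (n≢0⇒n>0 (unit≢0 {a} g)))

  #upper≡|J| : ∑ (λ a → 𝟙 (upper a)) (upTo d) ≡ length (J d)
  #upper≡|J| = count-by-bijection (J-enumerates d) upper (d ∸_) (upTo d) into one-preimage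
    where
    into : ∀ a → a ∈ upTo d → upper a ≡ true → inJ (d ∸ a) ≡ true
    into a am ua with upper⁻ {a} ua
    ... | d≤2a , g = inJ⁺ (n≢0⇒n>0 (m>n⇒m∸n≢0 a<d)) (2[d∸a]<d (<⇒≤ a<d) (≤∧≢⇒< d≤2a (λ e → 2*unit≢d {a} g (sym e))))
                          (gcd≡1-∸ (<⇒≤ a<d) g) (d∸a<d a<d g)
      where a<d = ∈-upTo⁻ d am
    one-preimage : ∀ j → j ∈ J d → ∑ (λ a → 𝟙 (upper a ∧ eqb _≟_ (d ∸ a) j)) (upTo d) ≡ 1
    one-preimage j jm with inJ⁻ {j} (sound (J-enumerates d) jm)
    ... | _ , 2j<d , gj , j<d =
      count-unique (upTo-enumerates d) (λ a → upper a ∧ eqb _≟_ (d ∸ a) j) (d ∸ j) (<ᵇ-true⁺ (d∸a<d j<d gj))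
        (∧-true⁺ (upper⁺ {d ∸ j} (d≤2[d∸a] (<⇒≤ j<d) 2j<d) (gcd≡1-∸ {j} {d} (<⇒≤ j<d) gj))
                 (eqb-true⁺ _≟_ {d ∸ (d ∸ j)} {j} (m∸[m∸n]≡n (<⇒≤ j<d))))
        (λ a am h → trans (sym (m∸[m∸n]≡n (<⇒≤ (∈-upTo⁻ d am))))
                          (cong (d ∸_) (eqb-true⁻ _≟_ {d ∸ a} {j} (proj₂ (∧-true⁻ {upper a} h)))))

  φ≡2*|J| : φ d ≡ 2 * length (J d)
  φ≡2*|J| = begin
    φ d                                                              ≡⟨ φ≡∑coprime d ⟩
    ∑ (λ a → 𝟙 (coprimeᵇ a d)) (upTo d)                              ≡⟨ ∑-cong (upTo d) (λ a _ → 𝟙-split ((2 * a) <ᵇ d) (coprimeᵇ a d)) ⟩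
    ∑ (λ a → 𝟙 (lower a) + 𝟙 (upper a)) (upTo d)                     ≡⟨ ∑-+ (λ a → 𝟙 (lower a)) (λ a → 𝟙 (upper a)) (upTo d) ⟩
    ∑ (λ a → 𝟙 (lower a)) (upTo d) + ∑ (λ a → 𝟙 (upper a)) (upTo d)  ≡⟨ cong₂ _+_ #lower≡|J| #upper≡|J| ⟩
    length (J d) + length (J d)                                      ≡⟨ sym (2*≡+ (length (J d))) ⟩
    2 * length (J d)                                                 ∎
    where open ≡-Reasoning

|J|≡φ̃ : ∀ d → length (J d) ≡ φ̃ d
|J|≡φ̃ zero = refl
|J|≡φ̃ (suc zero) = refl
|J|≡φ̃ (suc (suc zero)) = refl
|J|≡φ̃ d@(suc (suc (suc k))) = sym (trans (cong (_/ 2) (trans (Halves.φ≡2*|J| k) (*-comm 2 (length (J d))))) (m*n/n≡m (length (J d)) 2))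

φ≡2*φ̃ : ∀ {n} → 3 ≤ n → φ n ≡ 2 * φ̃ n
φ≡2*φ̃ {suc (suc zero)} (s≤s (s≤s ()))
φ≡2*φ̃ {n@(suc (suc (suc k)))} _ = trans (Halves.φ≡2*|J| k) (cong (2 *_) (|J|≡φ̃ n))

φ≡φ̃≡1 : ∀ {n} → 1 ≤ n → n ≤ 2 → φ n ≡ 1 × φ̃ n ≡ 1
φ≡φ̃≡1 {1} _ _ = refl , refl
φ≡φ̃≡1 {2} _ _ = refl , refl
φ≡φ̃≡1 {suc (suc (suc _))} _ (s≤s (s≤s ()))

-- Connectivity in the graph Γ

at-≥length : ∀ {es} i → length es ≤ i → at es i ≡ 0
at-≥length {[]} i h = refl
at-≥length {e ∷ es} (suc i) (s≤s h) = at-≥length {es} i h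

at-∈ : ∀ ds {i} → i < length ds → at ds i ∈ ds
at-∈ (d ∷ ds) {zero} _ = here refl
at-∈ (d ∷ ds) {suc i} (s≤s lt) = there (at-∈ ds lt)

∈⇒at : ∀ {d} ds → d ∈ ds → ∃ λ i → i < length ds × at ds i ≡ d
∈⇒at (e ∷ ds) (here refl) = 0 , s≤s z≤n , refl
∈⇒at (e ∷ ds) (there m) = let i , lt , eq = ∈⇒at ds m in suc i , s≤s lt , eq

least-witness : (p : ℕ → Bool) (v : ℕ) → p v ≡ true → ∃ λ u → p u ≡ true × (∀ u′ → u′ < u → p u′ ≡ false)
least-witness p zero h = zero , h , (λ _ ())
least-witness p (suc v) h with p 0 in p0
... | true = zero , p0 , (λ _ ())
... | false with least-witness (λ n → p (suc n)) v h
... | u , pu , below = suc u , pu , below′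
  where
  below′ : ∀ u′ → u′ < suc u → p u′ ≡ false
  below′ zero _ = p0
  below′ (suc u′) (s≤s lt) = below u′ lt

module Graph (ds : List ℕ) where

  q : ℕ
  q = length ds

  vertex⇒< : ∀ {i} → vertex ds i ≡ true → i < q
  vertex⇒< {i} h = ≰⇒> (λ ge → true≢false (trans (sym h) (cong (3 ≤ᵇ_) (at-≥length {ds} i ge))))

  vertex⇒3≤ : ∀ {i} → vertex ds i ≡ true → 3 ≤ at ds i
  vertex⇒3≤ = ≤ᵇ-true⁻

  ¬vertex⇒<3 : ∀ {i} → vertex ds i ≡ false → at ds i < 3
  ¬vertex⇒<3 h = ≰⇒> (λ le → true≢false (trans (sym (≤ᵇ-true⁺ le)) h))

  edge⁻ : ∀ {i j} → edge ds i j ≡ true → vertex ds i ≡ true × vertex ds j ≡ true × 3 ≤ gcd (at ds i) (at ds j)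
  edge⁻ {i} {j} e with ∧-true⁻ {vertex ds i} e
  ... | vi , r with ∧-true⁻ {vertex ds j} r
  ... | vj , r′ with ∧-true⁻ {not (i ≡ᵇ j)} r′
  ... | _ , g = vi , vj , ≤ᵇ-true⁻ g

  edge-sym : ∀ i j → edge ds i j ≡ edge ds j i
  edge-sym i j = swap (vertex ds i) (vertex ds j) (cong not (≡ᵇ-sym i j)) (cong (3 ≤ᵇ_) (gcd-comm (at ds i) (at ds j)))
    where
    swap : ∀ a b {c c′ g g′} → c ≡ c′ → g ≡ g′ → (a ∧ b ∧ c ∧ g) ≡ (b ∧ a ∧ c′ ∧ g′)
    swap true true refl refl = refl
    swap true false refl refl = refl
    swap false true refl refl = refl
    swap false false refl refl = refl

  walk-suc⁻ : ∀ k {i j} → walk ds (suc k) i j ≡ true →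
    walk ds k i j ≡ true ⊎ ∃ λ l → edge ds i l ≡ true × walk ds k l j ≡ true
  walk-suc⁻ k {i} {j} h with ∨-true⁻ {walk ds k i j} h
  ... | inj₁ w = inj₁ w
  ... | inj₂ w with any-true⁻ _ (upTo q) w
  ... | l , _ , e = inj₂ (l , ∧-true⁻ {edge ds i l} e)

  walk-zero⁻ : ∀ {i j} → walk ds 0 i j ≡ true → vertex ds i ≡ true × i ≡ j
  walk-zero⁻ {i} h = let v , e = ∧-true⁻ {vertex ds i} h in v , ≡ᵇ-true⁻ e

  walk-vertices : ∀ k {i j} → walk ds k i j ≡ true → vertex ds i ≡ true × vertex ds j ≡ true
  walk-vertices zero h with walk-zero⁻ h
  ... | v , refl = v , v
  walk-vertices (suc k) h with walk-suc⁻ k h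
  ... | inj₁ w = walk-vertices k w
  ... | inj₂ (l , e , w) = proj₁ (edge⁻ e) , proj₂ (walk-vertices k w)

  walk-refl : ∀ {i} → vertex ds i ≡ true → walk ds 0 i i ≡ true
  walk-refl {i} h = ∧-true⁺ h (≡ᵇ-true⁺ {i} refl)

  walk-suc : ∀ k {i j} → walk ds k i j ≡ true → walk ds (suc k) i j ≡ true
  walk-suc k h = ∨-true⁺ˡ _ h

  walk-mono : ∀ {k m i j} → k ≤ m → walk ds k i j ≡ true → walk ds m i j ≡ true
  walk-mono {k} {m} le h with m≤n⇒m<n∨m≡n le
  ... | inj₂ refl = h
  walk-mono {k} {suc m} le h | inj₁ (s≤s lt) = walk-suc m (walk-mono lt h)

  walk-edge : ∀ k {i l j} → edge ds i l ≡ true → walk ds k l j ≡ true → walk ds (suc k) i j ≡ true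
  walk-edge k {i} {l} {j} e w = ∨-true⁺ʳ (walk ds k i j)
    (any-true⁺ (λ l′ → edge ds i l′ ∧ walk ds k l′ j) (upTo q) (∈-upTo⁺ (vertex⇒< (proj₁ (walk-vertices k w)))) (∧-true⁺ e w))

  walk-++ : ∀ m n {i l j} → walk ds m i l ≡ true → walk ds n l j ≡ true → walk ds (m + n) i j ≡ true
  walk-++ zero n h₁ h₂ with walk-zero⁻ h₁
  ... | _ , refl = h₂
  walk-++ (suc m) n h₁ h₂ with walk-suc⁻ m h₁
  ... | inj₁ w = walk-suc (m + n) (walk-++ m n w h₂)
  ... | inj₂ (l′ , e , w) = walk-edge (m + n) e (walk-++ m n w h₂)

  edge⇒walk : ∀ {i j} → edge ds i j ≡ true → walk ds 1 i j ≡ true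
  edge⇒walk e = walk-edge 0 e (walk-refl (proj₁ (proj₂ (edge⁻ e))))

  walk-sym : ∀ k {i j} → walk ds k i j ≡ true → walk ds k j i ≡ true
  walk-sym zero h with walk-zero⁻ h
  ... | _ , refl = h
  walk-sym (suc k) {i} {j} h with walk-suc⁻ k h
  ... | inj₁ w = walk-suc k (walk-sym k w)
  ... | inj₂ (l , e , w) = subst (λ t → walk ds t j i ≡ true) (+-comm k 1)
                             (walk-++ k 1 (walk-sym k w) (edge⇒walk (trans (edge-sym l i) e)))

  walk-induction : (R : ℕ → ℕ → Set) → (∀ {i} → R i i) → (∀ {i l j} → edge ds i l ≡ true → R l j → R i j) →
    ∀ k {i j} → walk ds k i j ≡ true → R i j
  walk-induction R refl′ step zero h with walk-zero⁻ h
  ... | _ , refl = refl′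
  walk-induction R refl′ step (suc k) h with walk-suc⁻ k h
  ... | inj₁ w = walk-induction R refl′ step k w
  ... | inj₂ (l , e , w) = step e (walk-induction R refl′ step k w)

  -- The set of vertices reaching j within k steps grows strictly with k until it stabilises,
  -- and it has at most q elements; so it is stable from k = q on.
  module Saturation (j : ℕ) where

    reaches : ℕ → ℕ → Bool
    reaches k i = walk ds k i j

    reaches-≥q : ∀ k {i} → q ≤ i → reaches k i ≡ false
    reaches-≥q k {i} ge with reaches k i in e
    ... | true = ⊥-elim (<⇒≱ (vertex⇒< (proj₁ (walk-vertices k e))) ge)
    ... | false = refl

    Stable : ℕ → Set
    Stable k = ∀ i → reaches (suc k) i ≡ reaches k i

    stable-suc : ∀ k → Stable k → Stable (suc k)
    stable-suc k st i = trans (cong (reaches (suc k) i ∨_) (any-cong (λ l → cong (edge ds i l ∧_) (st l)) (upTo q)))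
                              (∨-absorb (reaches k i) _)
      where
      ∨-absorb : ∀ x a → ((x ∨ a) ∨ a) ≡ (x ∨ a)
      ∨-absorb true a = refl
      ∨-absorb false true = refl
      ∨-absorb false false = refl

    stable-+ : ∀ k → Stable k → ∀ m i → reaches (m + k) i ≡ reaches k i
    stable-+ k st zero i = refl
    stable-+ k st (suc m) i = trans (stable-from m i) (stable-+ k st m i)
      where
      stable-from : ∀ m → Stable (m + k)
      stable-from zero = st
      stable-from (suc m) = stable-suc (m + k) (stable-from m)

    #reaches : ℕ → ℕ
    #reaches k = ∑ (λ i → 𝟙 (reaches k i)) (upTo q)

    stable-or-grows : ∀ k → Stable k ⊎ #reaches k < #reaches (suc k)
    stable-or-grows k with all (λ i → eqb Bool._≟_ (reaches (suc k) i) (reaches k i)) (upTo q) in e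
    ... | true = inj₁ st
      where
      st : Stable k
      st i with i <? q
      ... | yes lt = eqb-true⁻ Bool._≟_ (all-true⁻ _ (upTo q) e (∈-upTo⁺ lt))
      ... | no nlt = trans (reaches-≥q (suc k) (≮⇒≥ nlt)) (sym (reaches-≥q k (≮⇒≥ nlt)))
    ... | false with all-false⁻ _ (upTo q) e
    ... | i , m , ne = let e₁ , e₂ = new (reaches (suc k) i) (reaches k i) refl refl ne in
                       inj₂ (∑𝟙-mono-< (reaches k) (reaches (suc k)) (upTo q) (λ x _ h → walk-suc k h) m e₁ e₂)
      where
      new : ∀ a b → reaches (suc k) i ≡ a → reaches k i ≡ b → eqb Bool._≟_ a b ≡ false → reaches (suc k) i ≡ true × reaches k i ≡ false
      new true false e₁ e₂ _ = e₁ , e₂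
      new false true e₁ e₂ _ = ⊥-elim (true≢false (trans (sym (walk-suc k e₂)) e₁))
      new true true _ _ ()
      new false false _ _ ()

    stable-before-or-large : ∀ k → (∃ λ k′ → k′ < k × Stable k′) ⊎ k ≤ #reaches k
    stable-before-or-large zero = inj₂ z≤n
    stable-before-or-large (suc k) with stable-before-or-large k
    ... | inj₁ (k′ , lt , st) = inj₁ (k′ , m≤n⇒m≤1+n lt , st)
    ... | inj₂ le with stable-or-grows k
    ... | inj₁ st = inj₁ (k , ≤-refl , st)
    ... | inj₂ lt = inj₂ (≤-trans (s≤s le) lt)

    stable-by-q : ∃ λ k′ → k′ ≤ q × Stable k′
    stable-by-q with stable-before-or-large (suc q)
    ... | inj₁ (k′ , s≤s lt , st) = k′ , lt , st
    ... | inj₂ le = ⊥-elim (<⇒≱ (s≤s (subst (#reaches (suc q) ≤_) (length-upTo q) (∑𝟙≤length (reaches (suc q)) (upTo q)))) le)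

    reaches⇒reaches-q : ∀ n i → reaches n i ≡ true → reaches q i ≡ true
    reaches⇒reaches-q n i h with n ≤? q
    ... | yes le = walk-mono le h
    ... | no nle with stable-by-q
    ... | k′ , le′ , st = walk-mono le′ (trans (sym (stable-+ k′ st (n ∸ k′) i))
                            (subst (λ t → reaches t i ≡ true) (sym (m∸n+n≡m (≤-trans le′ (<⇒≤ (≰⇒> nle))))) h))

  walk⇒connected : ∀ n {i j} → walk ds n i j ≡ true → connected ds i j ≡ true
  walk⇒connected n {i} {j} h = Saturation.reaches⇒reaches-q j n i h

  connected-refl : ∀ {i} → vertex ds i ≡ true → connected ds i i ≡ true
  connected-refl h = walk⇒connected 0 (walk-refl h)

  connected-sym : ∀ {i j} → connected ds i j ≡ true → connected ds j i ≡ true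
  connected-sym h = walk-sym q h

  connected-trans : ∀ {i l j} → connected ds i l ≡ true → connected ds l j ≡ true → connected ds i j ≡ true
  connected-trans h₁ h₂ = walk⇒connected (q + q) (walk-++ q q h₁ h₂)

  connected-vertices : ∀ {i j} → connected ds i j ≡ true → vertex ds i ≡ true × vertex ds j ≡ true
  connected-vertices h = walk-vertices q h

  edge⇒connected : ∀ {i j} → edge ds i j ≡ true → connected ds i j ≡ true
  edge⇒connected e = walk⇒connected 1 (edge⇒walk e)

  connected-induction : (R : ℕ → ℕ → Set) → (∀ {i} → R i i) → (∀ {i l j} → edge ds i l ≡ true → R l j → R i j) →
    ∀ {i j} → connected ds i j ≡ true → R i j
  connected-induction R refl′ step = walk-induction R refl′ step q

  leader : ℕ → Bool
  leader v = vertex ds v ∧ all (λ u → not (connected ds u v)) (upTo v)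

  components≡#leaders : components ds ≡ ∑ (λ v → 𝟙 (leader v)) (upTo q)
  components≡#leaders = countᵇ≡∑ leader (upTo q)

  leader⇒vertex : ∀ {r} → leader r ≡ true → vertex ds r ≡ true
  leader⇒vertex {r} h = proj₁ (∧-true⁻ {vertex ds r} h)

  leader-exists : ∀ {v} → vertex ds v ≡ true → ∃ λ r → leader r ≡ true × connected ds r v ≡ true
  leader-exists {v} hv with least-witness (λ u → connected ds u v) v (connected-refl hv)
  ... | u , cu , below = u , ∧-true⁺ (proj₁ (connected-vertices cu)) (all-true⁺ _ (upTo u) (λ m → not-true⁺ (nc (∈-upTo⁻ u m)))) , cu
    where
    nc : ∀ {u′} → u′ < u → connected ds u′ u ≡ false
    nc {u′} lt with connected ds u′ u in e
    ... | false = refl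
    ... | true = ⊥-elim (true≢false (trans (sym (connected-trans e cu)) (below u′ lt)))

  leader-minimal : ∀ {s t} → leader t ≡ true → s < t → connected ds s t ≡ false
  leader-minimal {s} {t} ht lt = not-true⁻ (all-true⁻ _ (upTo t) (proj₂ (∧-true⁻ {vertex ds t} ht)) (∈-upTo⁺ lt))

  leader-unique : ∀ {r r′} → leader r ≡ true → leader r′ ≡ true → connected ds r r′ ≡ true → r ≡ r′
  leader-unique {r} {r′} h h′ c with <-cmp r r′
  ... | tri≈ _ e _ = e
  ... | tri< lt _ _ = ⊥-elim (true≢false (trans (sym c) (leader-minimal h′ lt)))
  ... | tri> _ _ gt = ⊥-elim (true≢false (trans (sym (connected-sym c)) (leader-minimal h gt)))

choices : Bool → List Bool
choices true = true ∷ false ∷ []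
choices false = [ true ]

memChoice : Bool → Bool → Bool
memChoice true _ = true
memChoice false t = eqb Bool._≟_ t true

choices-enumerates : ∀ c → Enumerates Bool._≟_ (memChoice c) (choices c)
choices-enumerates true = record { sound = λ _ → refl ; once = λ { true _ → refl ; false _ → refl } }
choices-enumerates false = record { sound = λ { (here refl) → refl } ; once = λ { true _ → refl ; false () } }

patterns : (ℕ → Bool) → ℕ → List (List Bool)
patterns c zero = [ [] ]
patterns c (suc n) = prepend (choices (c 0)) (patterns (λ i → c (suc i)) n)

memPattern : (ℕ → Bool) → ℕ → List Bool → Bool
memPattern c zero = nilMem
memPattern c (suc n) = consMem (memChoice (c 0)) (memPattern (λ i → c (suc i)) n)

patterns-enumerates : ∀ c n → Enumerates (≡-dec Bool._≟_) (memPattern c n) (patterns c n)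
patterns-enumerates c zero = nil-enumerates Bool._≟_
patterns-enumerates c (suc n) = prepend-enumerates (choices-enumerates (c 0)) (patterns-enumerates (λ i → c (suc i)) n)

length-patterns : ∀ c n → length (patterns c n) ≡ 2 ^ ∑ (λ i → 𝟙 (c i)) (upTo n)
length-patterns c zero = refl
length-patterns c (suc n) = begin
  length (patterns c (suc n))                                               ≡⟨ length-prepend (choices (c 0)) _ ⟩
  length (choices (c 0)) * length (patterns (λ i → c (suc i)) n)            ≡⟨ cong₂ _*_ (length-choices (c 0)) (length-patterns (λ i → c (suc i)) n) ⟩
  2 ^ 𝟙 (c 0) * 2 ^ ∑ (λ i → 𝟙 (c (suc i))) (upTo n)                        ≡⟨ sym (^-distribˡ-+-* 2 (𝟙 (c 0)) _) ⟩
  2 ^ (𝟙 (c 0) + ∑ (λ i → 𝟙 (c (suc i))) (upTo n))                          ≡⟨ cong (2 ^_) (sym (∑-upTo-suc (λ i → 𝟙 (c i)) n)) ⟩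
  2 ^ ∑ (λ i → 𝟙 (c i)) (upTo (suc n))                                      ∎
  where
  open ≡-Reasoning
  length-choices : ∀ b → length (choices b) ≡ 2 ^ 𝟙 b
  length-choices true = refl
  length-choices false = refl

-- Out-of-range entries read as true, like the fixed coordinates.
atB : List Bool → ℕ → Bool
atB [] _ = true
atB (x ∷ xs) zero = x
atB (x ∷ xs) (suc i) = atB xs i

memPattern⁻ : ∀ c n σ → memPattern c n σ ≡ true → length σ ≡ n × (∀ i → c i ≡ false → atB σ i ≡ true)
memPattern⁻ c zero [] h = refl , (λ _ _ → refl)
memPattern⁻ c (suc n) (t ∷ σ) h with ∧-true⁻ {memChoice (c 0) t} h
... | h₀ , hσ with memPattern⁻ (λ i → c (suc i)) n σ hσ
... | len , fixed = cong suc len , fixed′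
  where
  fixed′ : ∀ i → c i ≡ false → atB (t ∷ σ) i ≡ true
  fixed′ zero e rewrite e = eqb-true⁻ Bool._≟_ h₀
  fixed′ (suc i) e = fixed i e

atB-applyUpTo : ∀ h n {i} → i < n → atB (applyUpTo h n) i ≡ h i
atB-applyUpTo h (suc n) {zero} _ = refl
atB-applyUpTo h (suc n) {suc i} (s≤s lt) = atB-applyUpTo (λ j → h (suc j)) n lt

memPattern-applyUpTo : ∀ c n h → (∀ i → c i ≡ false → h i ≡ true) → memPattern c n (applyUpTo h n) ≡ true
memPattern-applyUpTo c zero h fixed = refl
memPattern-applyUpTo c (suc n) h fixed =
  ∧-true⁺ (head (c 0) refl) (memPattern-applyUpTo (λ i → c (suc i)) n (λ i → h (suc i)) (λ i → fixed (suc i)))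
  where
  head : ∀ b → c 0 ≡ b → memChoice b (h 0) ≡ true
  head true _ = refl
  head false e rewrite fixed 0 e = refl

atB-ext : ∀ n (σ τ : List Bool) → length σ ≡ n → length τ ≡ n → (∀ i → i < n → atB σ i ≡ atB τ i) → σ ≡ τ
atB-ext zero [] [] _ _ _ = refl
atB-ext (suc n) (s ∷ σ) (t ∷ τ) l₁ l₂ f =
  cong₂ _∷_ (f 0 (s≤s z≤n)) (atB-ext n σ τ (suc-injective l₁) (suc-injective l₂) (λ i lt → f (suc i) (s≤s lt)))

∣2⇒≡1⊎≡2 : ∀ {u} → u ∣ 2 → u ≡ 1 ⊎ u ≡ 2
∣2⇒≡1⊎≡2 {zero} h with 0∣⇒≡0 h
... | ()
∣2⇒≡1⊎≡2 {suc zero} h = inj₁ refl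
∣2⇒≡1⊎≡2 {suc (suc zero)} h = inj₂ refl
∣2⇒≡1⊎≡2 {suc (suc (suc u))} h = ⊥-elim (<⇒≱ (s≤s (s≤s (s≤s z≤n))) (∣⇒≤ h))

<3⇒∣2 : ∀ {d} → 1 ≤ d → d < 3 → d ∣ 2
<3⇒∣2 {1} _ _ = 1∣ 2
<3⇒∣2 {2} _ _ = ∣-refl
<3⇒∣2 {suc (suc (suc _))} _ (s≤s (s≤s (s≤s ())))

-- With y′ = y / gcd(x, y) we have lcm(x, y) = x y′.  Put g = gcd(x y′, d) and u = gcd(g, x), so
-- u ∣ gcd(x, d) ∣ 2 and g / u ∣ y′ ∣ y, hence g / u ∣ gcd(y, d) ∣ 2.  If u = g / u = 2 then 2 ∣ x
-- and 2 ∣ y′, so 4 ∣ gcd(x, y) y′ = y and 4 ∣ gcd(y, d) ∣ 2, which is absurd.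
gcd[lcm,d]∣2 : ∀ x y d → x ≢ 0 → d ≢ 0 → gcd x d ∣ 2 → gcd y d ∣ 2 → gcd (lcm x y) d ∣ 2
gcd[lcm,d]∣2 zero y d x≢0 _ _ _ = ⊥-elim (x≢0 refl)
gcd[lcm,d]∣2 x@(suc _) y d _ d≢0 hx hy = combine (∣2⇒≡1⊎≡2 u∣2) (∣2⇒≡1⊎≡2 g₁∣2)
  where
  w = gcd x y
  instance
    w-nonZero : NonZero w
    w-nonZero = ≢-nonZero (gcd[m,n]≢0 x y (inj₁ (λ ())))
  y′ = y / w
  g = gcd (x * y′) d
  g∣d : g ∣ d
  g∣d = gcd[m,n]∣n (x * y′) d
  u = gcd g x
  instance
    u-nonZero : NonZero u
    u-nonZero = ≢-nonZero (gcd[m,n]≢0 g x (inj₁ (gcd[m,n]≢0 (x * y′) d (inj₂ d≢0))))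
  u∣2 : u ∣ 2
  u∣2 = ∣-trans (gcd-greatest (gcd[m,n]∣n g x) (∣-trans (gcd[m,n]∣m g x) g∣d)) hx
  g₁ = g / u
  x₁ = x / u
  g≡ : u * g₁ ≡ g
  g≡ = m*[n/m]≡n (gcd[m,n]∣m g x)
  x≡ : u * x₁ ≡ x
  x≡ = m*[n/m]≡n (gcd[m,n]∣n g x)
  y≡ : w * y′ ≡ y
  y≡ = m*[n/m]≡n (gcd[m,n]∣n x y)
  g₁∣y′ : g₁ ∣ y′
  g₁∣y′ = coprime-divisor (coprime-/gcd g x)
    (*-cancelˡ-∣ u (subst₂ _∣_ (sym g≡) (trans (cong (_* y′) (sym x≡)) (*-assoc u x₁ y′)) (gcd[m,n]∣m (x * y′) d)))
  y′∣y : y′ ∣ y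
  y′∣y = divides w (sym y≡)
  g₁∣2 : g₁ ∣ 2
  g₁∣2 = ∣-trans (gcd-greatest (∣-trans g₁∣y′ y′∣y) (∣-trans (divides u (sym g≡)) g∣d)) hy
  combine : u ≡ 1 ⊎ u ≡ 2 → g₁ ≡ 1 ⊎ g₁ ≡ 2 → g ∣ 2
  combine (inj₁ e) _ = subst (_∣ 2) (trans (sym (*-identityˡ g₁)) (trans (cong (_* g₁) (sym e)) g≡)) g₁∣2
  combine (inj₂ e) (inj₁ e′) = subst (_∣ 2) (trans (sym (*-identityʳ u)) (trans (cong (u *_) (sym e′)) g≡)) u∣2
  combine (inj₂ e) (inj₂ e′) = ⊥-elim (<⇒≱ (s≤s (s≤s (s≤s z≤n))) (∣⇒≤ 4∣2))
    where
    2∣y′ : 2 ∣ y′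
    2∣y′ = subst (_∣ y′) e′ g₁∣y′
    2∣w : 2 ∣ w
    2∣w = gcd-greatest (subst (_∣ x) e (gcd[m,n]∣n g x)) (∣-trans 2∣y′ y′∣y)
    4∣2 : 4 ∣ 2
    4∣2 = ∣-trans (gcd-greatest (subst (4 ∣_) y≡ (*-pres-∣ 2∣w 2∣y′)) (subst (_∣ d) (trans (sym g≡) (cong₂ _*_ e e′)) g∣d)) hy

gcd[lcmList,d]∣2 : ∀ As d → (∀ a → a ∈ As → a ≢ 0) → d ≢ 0 → (∀ a → a ∈ As → gcd a d ∣ 2) → gcd (lcmList As) d ∣ 2
gcd[lcmList,d]∣2 [] d _ _ _ = subst (_∣ 2) (sym (gcd-zeroˡ d)) (1∣ 2)
gcd[lcmList,d]∣2 (a ∷ As) d nz d≢0 h = gcd[lcm,d]∣2 a (lcmList As) d (nz a (here refl)) d≢0 (h a (here refl))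
  (gcd[lcmList,d]∣2 As d (λ x m → nz x (there m)) d≢0 (λ x m → h x (there m)))

gcd[lcmList,lcmList]∣2 : ∀ As Bs → (∀ a → a ∈ As → a ≢ 0) → (∀ b → b ∈ Bs → b ≢ 0) →
  (∀ a b → a ∈ As → b ∈ Bs → gcd a b ∣ 2) → gcd (lcmList As) (lcmList Bs) ∣ 2
gcd[lcmList,lcmList]∣2 As [] nA nB h = subst (_∣ 2) (sym (gcd-zeroʳ (lcmList As))) (1∣ 2)
gcd[lcmList,lcmList]∣2 As (b ∷ Bs) nA nB h = subst (_∣ 2) (gcd-comm (lcm b (lcmList Bs)) (lcmList As))
  (gcd[lcm,d]∣2 b (lcmList Bs) (lcmList As) (nB b (here refl)) (lcmList≢0 As nA)
    (subst (_∣ 2) (gcd-comm (lcmList As) b) (gcd[lcmList,d]∣2 As b nA (nB b (here refl)) (λ a m → h a b m (here refl))))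
    (subst (_∣ 2) (gcd-comm (lcmList As) (lcmList Bs))
      (gcd[lcmList,lcmList]∣2 As Bs nA (λ x m → nB x (there m)) (λ a x m m′ → h a x m (there m′)))))

-- c = 1 + k A is then ≡ 1 (mod A) and ≡ -1 (mod B).  From Bézout, t g = 2 with g = gcd(B, A) and t = 2 / g.
crt-±1 : ∀ A B → B ≢ 0 → gcd A B ∣ 2 → ∃ λ k → B ∣ k * A + 2
crt-±1 A zero B≢0 _ = ⊥-elim (B≢0 refl)
crt-±1 A B@(suc β) _ hg = from-bézout (∣2⇒≡1⊎≡2 (subst (_∣ 2) (gcd-comm A B) hg)) (Bézout.identity (gcd-GCD B A))
  where
  open +-*-Solver
  g = gcd B A
  t : g ≡ 1 ⊎ g ≡ 2 → ℕ
  t (inj₁ _) = 2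
  t (inj₂ _) = 1
  t*g≡2 : ∀ p → t p * g ≡ 2
  t*g≡2 (inj₁ e) = cong (2 *_) e
  t*g≡2 (inj₂ e) = trans (*-identityˡ g) e
  from-bézout : (p : g ≡ 1 ⊎ g ≡ 2) → Bézout.Identity g B A → ∃ λ k → B ∣ k * A + 2
  from-bézout p (Bézout.Identity.+- x y eq) = t p * y , divides (t p * x) (begin
    t p * y * A + 2          ≡⟨ cong (t p * y * A +_) (sym (t*g≡2 p)) ⟩
    t p * y * A + t p * g    ≡⟨ solve 4 (λ T Y A′ G → T :* Y :* A′ :+ T :* G := T :* (G :+ Y :* A′)) refl (t p) y A g ⟩
    t p * (g + y * A)        ≡⟨ cong (t p *_) eq ⟩
    t p * (x * B)            ≡⟨ sym (*-assoc (t p) x B) ⟩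
    t p * x * B              ∎)
    where open ≡-Reasoning
  from-bézout p (Bézout.Identity.-+ x y eq) = t p * y * β , divides (2 + t p * β * x) (begin
    t p * y * β * A + 2                  ≡⟨ solve 4 (λ T Y b A′ → T :* Y :* b :* A′ :+ con 2 := T :* b :* (Y :* A′) :+ con 2) refl (t p) y β A ⟩
    t p * β * (y * A) + 2                ≡⟨ cong (λ z → t p * β * z + 2) (sym eq) ⟩
    t p * β * (g + x * B) + 2            ≡⟨ solve 5 (λ T b G X B′ → T :* b :* (G :+ X :* B′) :+ con 2
                                                         := b :* (T :* G) :+ T :* b :* X :* B′ :+ con 2) refl (t p) β g x B ⟩
    β * (t p * g) + t p * β * x * B + 2  ≡⟨ cong (λ z → β * z + t p * β * x * B + 2) (t*g≡2 p) ⟩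
    β * 2 + t p * β * x * suc β + 2      ≡⟨ solve 3 (λ b T X → b :* con 2 :+ T :* b :* X :* (con 1 :+ b) :+ con 2
                                                         := (con 2 :+ T :* b :* X) :* (con 1 :+ b)) refl β (t p) x ⟩
    (2 + t p * β * x) * suc β            ∎)
    where open ≡-Reasoning

%≡%⇒∣∸ : ∀ d .{{_ : NonZero d}} b b′ → b % d ≡ b′ % d → d ∣ b′ ∸ b
%≡%⇒∣∸ d b b′ e = divides (b′ / d ∸ b / d) (begin
    b′ ∸ b                                       ≡⟨ cong₂ _∸_ (m≡m%n+[m/n]*n b′ d) (m≡m%n+[m/n]*n b d) ⟩
    (b′ % d + b′ / d * d) ∸ (b % d + b / d * d)  ≡⟨ cong (λ z → (z + b′ / d * d) ∸ (b % d + b / d * d)) (sym e) ⟩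
    (b % d + b′ / d * d) ∸ (b % d + b / d * d)   ≡⟨ [m+n]∸[m+o]≡n∸o (b % d) (b′ / d * d) (b / d * d) ⟩
    b′ / d * d ∸ b / d * d                       ≡⟨ sym (*-distribʳ-∸ d (b′ / d) (b / d)) ⟩
    (b′ / d ∸ b / d) * d                         ∎)
  where open ≡-Reasoning

rep≡1⇒±1 : ∀ d b → 3 ≤ d → rep d (modN b d) ≡ 1 → modN b d ≡ 1 ⊎ (modN (b + 1) d ≡ 0 × modN b d ≢ 1)
rep≡1⇒±1 (suc zero) b (s≤s ()) h
rep≡1⇒±1 (suc (suc zero)) b (s≤s (s≤s ())) h
rep≡1⇒±1 d@(suc (suc (suc k))) b _ h with Signed.rep-cases k (b % d)
... | inj₁ (_ , q) = inj₁ (trans (sym q) h)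
... | inj₂ (_ , q) = inj₂ (b+1≡0 , λ e → 2+k≢1 (trans (sym b%d≡2+k) e))
  where
  2+k≢1 : suc (suc k) ≢ 1
  2+k≢1 ()
  b%d≡2+k : b % d ≡ suc (suc k)
  b%d≡2+k = trans (sym (m∸[m∸n]≡n (m%n≤n b d))) (cong (d ∸_) (trans (sym q) h))
  b+1≡0 : (b + 1) % d ≡ 0
  b+1≡0 = trans (Mod.+-congˡ d {b} {suc (suc k)} 1 (trans b%d≡2+k (sym (m<n⇒m%n≡m (n<1+n (suc (suc k)))))))
                (trans (cong (_% d) (+-comm (suc (suc k)) 1)) (n%n≡0 d))

≡1⇒rep≡1 : ∀ d b → 3 ≤ d → modN b d ≡ modN 1 d → rep d (modN b d) ≡ 1
≡1⇒rep≡1 (suc zero) b (s≤s ()) e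
≡1⇒rep≡1 (suc (suc zero)) b (s≤s (s≤s ())) e
≡1⇒rep≡1 d@(suc (suc (suc k))) b _ e = cong (rep d) e

≡-1⇒rep≡1 : ∀ d b → 3 ≤ d → modN (b + 1) d ≡ 0 → rep d (modN b d) ≡ 1
≡-1⇒rep≡1 (suc zero) b (s≤s ()) e
≡-1⇒rep≡1 (suc (suc zero)) b (s≤s (s≤s ())) e
≡-1⇒rep≡1 (suc (suc (suc k))) b _ e = Signed.rep-cong k {b} {1} (inj₂ e)

<3⇒rep≡1 : ∀ d x → d < 3 → rep d x ≡ 1
<3⇒rep≡1 zero x _ = refl
<3⇒rep≡1 (suc zero) x _ = refl
<3⇒rep≡1 (suc (suc zero)) x _ = refl
<3⇒rep≡1 (suc (suc (suc _))) x (s≤s (s≤s (s≤s ())))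

1≢-1 : ∀ g b .{{_ : NonZero g}} → 3 ≤ g → b % g ≡ 1 % g → (b + 1) % g ≢ 0
1≢-1 g b 3≤g e₁ e₂ = <⇒≱ (s≤s (s≤s (s≤s z≤n))) (≤-trans 3≤g (∣⇒≤ (m%n≡0⇒n∣m 2 g (trans (sym (Mod.+-congˡ g 1 e₁)) e₂))))

≡-1⇒≢1 : ∀ d b → 3 ≤ d → modN (b + 1) d ≡ 0 → modN b d ≢ 1
≡-1⇒≢1 (suc zero) b (s≤s ()) e₁ e₂
≡-1⇒≢1 (suc (suc zero)) b (s≤s (s≤s ())) e₁ e₂
≡-1⇒≢1 d@(suc (suc (suc k))) b 3≤d e₁ e₂ = 1≢-1 d b 3≤d (trans e₂ (sym (m<n⇒m%n≡m 1<d))) e₁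
  where
  1<d : 1 < d
  1<d = s≤s (s≤s z≤n)

≡1⇒gcd≡1 : ∀ d b → d ≢ 0 → modN b d ≡ modN 1 d → gcd b d ≡ 1
≡1⇒gcd≡1 zero b d≢0 _ = ⊥-elim (d≢0 refl)
≡1⇒gcd≡1 d@(suc _) b _ e = trans (sym (gcd[m%n,n]≡gcd[m,n] b d)) (trans (cong (λ t → gcd t d) e) (trans (gcd[m%n,n]≡gcd[m,n] 1 d) (gcd-zeroˡ d)))

≡-1⇒gcd≡1 : ∀ d b → d ≢ 0 → modN (b + 1) d ≡ 0 → gcd b d ≡ 1
≡-1⇒gcd≡1 zero b d≢0 _ = ⊥-elim (d≢0 refl)
≡-1⇒gcd≡1 d@(suc _) b _ e = gcd≡1⁺ (λ {x} xb xd → ∣m+n∣m⇒∣n (∣-trans xd (m%n≡0⇒n∣m (b + 1) d e)) xb)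

≡-1⇒≡d∸1 : ∀ d b → d ≢ 0 → modN (b + 1) d ≡ 0 → modN b d ≡ d ∸ 1
≡-1⇒≡d∸1 zero b d≢0 _ = ⊥-elim (d≢0 refl)
≡-1⇒≡d∸1 d@(suc _) b _ e = %-pred-≡0 {b} {d} (trans (cong (_% d) (+-comm 1 b)) e)

±1-clash : ∀ dᵢ dⱼ b → 3 ≤ gcd dᵢ dⱼ → dᵢ ≢ 0 → dⱼ ≢ 0 → modN b dᵢ ≡ 1 → modN (b + 1) dⱼ ≡ 0 → ⊥
±1-clash zero dⱼ b _ n _ _ _ = n refl
±1-clash (suc _) zero b _ _ n _ _ = n refl
±1-clash dᵢ@(suc _) dⱼ@(suc _) b g3 _ _ e₁ e₂ = 1≢-1 g b {{g-nonZero}} g3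
  (trans (sym (m∣n⇒o%n%m≡o%m g dᵢ b {{g-nonZero}} (gcd[m,n]∣m dᵢ dⱼ))) (cong (λ t → _%_ t g {{g-nonZero}}) e₁))
  (trans (sym (m∣n⇒o%n%m≡o%m g dⱼ (b + 1) {{g-nonZero}} (gcd[m,n]∣n dᵢ dⱼ)))
    (trans (cong (λ t → _%_ t g {{g-nonZero}}) e₂) (Mod.0%n≡0 g {{g-nonZero}})))
  where
  g = gcd dᵢ dⱼ
  g-nonZero : NonZero g
  g-nonZero = ≢-nonZero (gcd[m,n]≢0 dᵢ dⱼ (inj₁ (λ ())))

<3⇒units-agree : ∀ d b b′ → 1 ≤ d → d < 3 → gcd b d ≡ 1 → gcd b′ d ≡ 1 → modN b d ≡ modN b′ d
<3⇒units-agree (suc zero) b b′ _ _ _ _ = trans (n%1≡0 b) (sym (n%1≡0 b′))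
<3⇒units-agree (suc (suc zero)) b b′ _ _ g g′ = trans (odd b g) (sym (odd b′ g′))
  where
  odd : ∀ b → gcd b 2 ≡ 1 → b % 2 ≡ 1
  odd b h with b % 2 in e | m%n<n b 2
  ... | 0 | _ = ⊥-elim (2≢1 (∣1⇒≡1 (subst (2 ∣_) h (gcd-greatest (m%n≡0⇒n∣m b 2 e) ∣-refl))))
    where 2≢1 : 2 ≢ 1
          2≢1 ()
  ... | 1 | _ = refl
  ... | suc (suc _) | s≤s (s≤s ())
<3⇒units-agree (suc (suc (suc _))) b b′ _ (s≤s (s≤s (s≤s ()))) _ _

±1-solution : ∀ As Bs → (∀ a → a ∈ As → a ≢ 0) → (∀ b → b ∈ Bs → b ≢ 0) → (∀ a b → a ∈ As → b ∈ Bs → gcd a b ∣ 2) →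
  ∃ λ c → (∀ a → a ∈ As → modN c a ≡ modN 1 a) × (∀ b → b ∈ Bs → modN (c + 1) b ≡ 0)
±1-solution As Bs nA nB h with crt-±1 (lcmList As) (lcmList Bs) (lcmList≢0 Bs nB) (gcd[lcmList,lcmList]∣2 As Bs nA nB h)
... | k , B∣ = 1 + k * lcmList As , (λ a am → plus a (∈⇒∣lcmList As am) (nA a am)) , (λ b bm → minus b (∈⇒∣lcmList Bs bm) (nB b bm))
  where
  plus : ∀ d → d ∣ lcmList As → d ≢ 0 → modN (1 + k * lcmList As) d ≡ modN 1 d
  plus zero _ n = ⊥-elim (n refl)
  plus (suc _) dA _ = %-remove-+ʳ 1 (∣n⇒∣m*n k dA)
  minus : ∀ d → d ∣ lcmList Bs → d ≢ 0 → modN (1 + k * lcmList As + 1) d ≡ 0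
  minus zero _ n = ⊥-elim (n refl)
  minus d@(suc _) dB _ = n∣m⇒m%n≡0 _ d (subst (d ∣_) (+-suc (k * lcmList As) 1) (∣-trans dB B∣))

-- The stabiliser

module Stabiliser (ds : List ℕ) (pos : All (1 ≤_) ds) where
  open UnitAction ds pos
  open Graph ds

  sign : ℕ → ℕ → Bool
  sign b i = eqb _≟_ (modN b (at ds i)) 1

  at≢0 : ∀ {i} → i < q → at ds i ≢ 0
  at≢0 lt = ds≢0 _ (at-∈ ds lt)

  sign-cases : ∀ {b i} → fixesAll ds b ≡ true → vertex ds i ≡ true →
    (sign b i ≡ true × modN b (at ds i) ≡ 1) ⊎ (sign b i ≡ false × modN (b + 1) (at ds i) ≡ 0)
  sign-cases {b} {i} h v with rep≡1⇒±1 (at ds i) b (vertex⇒3≤ v) (fixesAll⁻ ds b h (at ds i) (at-∈ ds (vertex⇒< v)))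
  ... | inj₁ e = inj₁ (eqb-true⁺ _≟_ e , e)
  ... | inj₂ (e , ne) = inj₂ (eqb-false⁺ _≟_ ne , e)

  edge-sign : ∀ {b} → fixesAll ds b ≡ true → ∀ {i j} → edge ds i j ≡ true → sign b i ≡ sign b j
  edge-sign {b} h {i} {j} e with edge⁻ e
  ... | vi , vj , g3 with sign-cases {b} {i} h vi | sign-cases {b} {j} h vj
  ... | inj₁ (s₁ , _) | inj₁ (s₂ , _) = trans s₁ (sym s₂)
  ... | inj₂ (s₁ , _) | inj₂ (s₂ , _) = trans s₁ (sym s₂)
  ... | inj₁ (_ , e₁) | inj₂ (_ , e₂) =
    ⊥-elim (±1-clash (at ds i) (at ds j) b g3 (at≢0 (vertex⇒< vi)) (at≢0 (vertex⇒< vj)) e₁ e₂)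
  ... | inj₂ (_ , e₂) | inj₁ (_ , e₁) =
    ⊥-elim (±1-clash (at ds j) (at ds i) b (subst (3 ≤_) (gcd-comm (at ds i) (at ds j)) g3) (at≢0 (vertex⇒< vj)) (at≢0 (vertex⇒< vi)) e₁ e₂)

  connected-sign : ∀ {b} → fixesAll ds b ≡ true → ∀ {i j} → connected ds i j ≡ true → sign b i ≡ sign b j
  connected-sign {b} h = connected-induction (λ i j → sign b i ≡ sign b j) refl (λ e r → trans (edge-sign h e) r)

  sign-determines-residue : ∀ {b b′ i} → fixesAll ds b ≡ true → fixesAll ds b′ ≡ true → vertex ds i ≡ true →
    sign b i ≡ sign b′ i → modN b (at ds i) ≡ modN b′ (at ds i)
  sign-determines-residue {b} {b′} {i} hb hb′ vi es with sign-cases {b} {i} hb vi | sign-cases {b′} {i} hb′ vi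
  ... | inj₁ (_ , e₁) | inj₁ (_ , e₂) = trans e₁ (sym e₂)
  ... | inj₁ (s₁ , _) | inj₂ (s₂ , _) = ⊥-elim (true≢false (trans (sym s₁) (trans es s₂)))
  ... | inj₂ (s₁ , _) | inj₁ (s₂ , _) = ⊥-elim (true≢false (trans (sym s₂) (trans (sym es) s₁)))
  ... | inj₂ (_ , e₁) | inj₂ (_ , e₂) = trans (≡-1⇒≡d∸1 (at ds i) b d≢0 e₁) (sym (≡-1⇒≡d∸1 (at ds i) b′ d≢0 e₂))
    where d≢0 = at≢0 (vertex⇒< vi)

  ≤-≡-mod-ds⇒≡ : ∀ {x y} → x ≤ y → y < L → (∀ d → d ∈ ds → modN x d ≡ modN y d) → x ≡ y
  ≤-≡-mod-ds⇒≡ {x} {y} le ly h with y ∸ x ≟ 0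
  ... | yes e = ≤-antisym le (m∸n≡0⇒m≤n e)
  ... | no ne = ⊥-elim (<⇒≱ (≤-trans (s≤s (m∸n≤m y x)) ly) (∣⇒≤ {{≢-nonZero ne}} (lcmList-least ds d∣y∸x)))
    where
    d∣y∸x : ∀ d → d ∈ ds → d ∣ y ∸ x
    d∣y∸x zero m = ⊥-elim (ds≢0 0 m refl)
    d∣y∸x (suc k) m = %≡%⇒∣∸ (suc k) x y (h (suc k) m)

  ≡-mod-ds⇒≡ : ∀ {b b′} → b < L → b′ < L → (∀ d → d ∈ ds → modN b d ≡ modN b′ d) → b ≡ b′
  ≡-mod-ds⇒≡ {b} {b′} lb lb′ h with ≤-total b b′
  ... | inj₁ le = ≤-≡-mod-ds⇒≡ le lb′ h
  ... | inj₂ le = sym (≤-≡-mod-ds⇒≡ le lb (λ d m → sym (h d m)))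

  leader-signs-determine : ∀ {b b′} → isUnit b ≡ true → isUnit b′ ≡ true → fixesAll ds b ≡ true → fixesAll ds b′ ≡ true →
    (∀ r → leader r ≡ true → sign b r ≡ sign b′ r) → b ≡ b′
  leader-signs-determine {b} {b′} ub ub′ hb hb′ same = ≡-mod-ds⇒≡ (proj₂ (isUnit⁻ {b} ub)) (proj₂ (isUnit⁻ {b′} ub′)) residues
    where
    residues : ∀ d → d ∈ ds → modN b d ≡ modN b′ d
    residues d dm with ∈⇒at ds dm
    ... | i , lt , refl with vertex ds i in vi
    ... | true with leader-exists vi
    ...   | r , lr , cr = sign-determines-residue hb hb′ vi
                            (trans (sym (connected-sign hb cr)) (trans (same r lr) (connected-sign hb′ cr)))
    residues d dm | i , lt , refl | false = <3⇒units-agree (at ds i) b b′ (All.lookup pos dm) (¬vertex⇒<3 vi)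
      (gcd≡1-ds {b} (proj₁ (isUnit⁻ {b} ub)) _ dm) (gcd≡1-ds {b′} (proj₁ (isUnit⁻ {b′} ub′)) _ dm)

  signPattern : ℕ → List Bool
  signPattern b = applyUpTo (λ i → if leader i then sign b i else true) q

  memPattern-signPattern : ∀ b → memPattern leader q (signPattern b) ≡ true
  memPattern-signPattern b = memPattern-applyUpTo leader q _ (λ i e → cong (if_then sign b i else true) e)

  atB-signPattern : ∀ b {r} → leader r ≡ true → atB (signPattern b) r ≡ sign b r
  atB-signPattern b {r} lr = trans (atB-applyUpTo _ q (vertex⇒< (leader⇒vertex lr))) (cong (if_then sign b r else true) lr)

  -- The component of a vertex i takes the sign σ prescribes for its leader; a unit with these signs
  -- exists by the Chinese remainder theorem, since moduli of distinct components have gcd ≤ 2.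
  module Realise (σ : List Bool) (hσ : memPattern leader q σ ≡ true) where

    chosen : ℕ → Bool
    chosen i = any (λ r → leader r ∧ connected ds r i ∧ atB σ r) (upTo q)

    chosen-leader : ∀ {r} → leader r ≡ true → chosen r ≡ atB σ r
    chosen-leader {r} lr = bool-ext fwd bwd
      where
      fwd : chosen r ≡ true → atB σ r ≡ true
      fwd h with any-true⁻ _ (upTo q) h
      ... | r′ , _ , e with ∧-true⁻ {leader r′} e
      ... | lr′ , c with ∧-true⁻ {connected ds r′ r} c
      ... | c′ , a with leader-unique lr′ lr c′
      ... | refl = a
      bwd : atB σ r ≡ true → chosen r ≡ true
      bwd h = any-true⁺ _ (upTo q) (∈-upTo⁺ (vertex⇒< (leader⇒vertex lr)))
                (∧-true⁺ lr (∧-true⁺ (connected-refl (leader⇒vertex lr)) h))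

    chosen-connected : ∀ {i j} → connected ds i j ≡ true → chosen i ≡ chosen j
    chosen-connected c = bool-ext (along c) (along (connected-sym c))
      where
      along : ∀ {i j} → connected ds i j ≡ true → chosen i ≡ true → chosen j ≡ true
      along {i} c h with any-true⁻ _ (upTo q) h
      ... | r , rm , e with ∧-true⁻ {leader r} e
      ... | lr , c′ with ∧-true⁻ {connected ds r i} c′
      ... | cri , a = any-true⁺ _ (upTo q) rm (∧-true⁺ lr (∧-true⁺ (connected-trans cri c) a))

    plus : ℕ → Bool
    plus i = not (vertex ds i) ∨ chosen i

    plus-false⁻ : ∀ {j} → plus j ≡ false → vertex ds j ≡ true × chosen j ≡ false
    plus-false⁻ {j} h with vertex ds j | chosen j
    ... | true | false = refl , refl

    plusMods minusMods : List ℕ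
    plusMods = map (at ds) (filterᵇ plus (upTo q))
    minusMods = map (at ds) (filterᵇ (λ i → not (plus i)) (upTo q))

    ∈-mods⁻ : ∀ p {a} → a ∈ map (at ds) (filterᵇ p (upTo q)) → ∃ λ i → i < q × p i ≡ true × a ≡ at ds i
    ∈-mods⁻ p am with ∈-map⁻ (at ds) am
    ... | i , im , refl with ∈-filterᵇ⁻ p (upTo q) im
    ... | iu , pi = i , ∈-upTo⁻ q iu , pi , refl

    ∈-mods⁺ : ∀ p {i} → i < q → p i ≡ true → at ds i ∈ map (at ds) (filterᵇ p (upTo q))
    ∈-mods⁺ p lt pi = ∈-map⁺ (at ds) (complete (filterᵇ-enumerates (upTo-enumerates q) p) (∧-true⁺ pi (<ᵇ-true⁺ lt)))

    mods≢0 : ∀ p a → a ∈ map (at ds) (filterᵇ p (upTo q)) → a ≢ 0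
    mods≢0 p a am with ∈-mods⁻ p am
    ... | i , lt , _ , refl = at≢0 lt

    plus-minus-gcd∣2 : ∀ a b → a ∈ plusMods → b ∈ minusMods → gcd a b ∣ 2
    plus-minus-gcd∣2 a b am bm with ∈-mods⁻ plus am | ∈-mods⁻ (λ i → not (plus i)) bm
    ... | i , li , pi , refl | j , lj , pj , refl with plus-false⁻ {j} (not-true⁻ pj)
    ... | vj , ¬cj with vertex ds i in vi
    ... | false = ∣-trans (gcd[m,n]∣m (at ds i) (at ds j)) (<3⇒∣2 (All.lookup pos (at-∈ ds li)) (¬vertex⇒<3 vi))
    ... | true = <3⇒∣2 (n≢0⇒n>0 (gcd[m,n]≢0 (at ds i) (at ds j) (inj₁ (at≢0 li)))) (≰⇒> no-edge)
      where
      ¬connected : connected ds i j ≡ true → ⊥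
      ¬connected c = true≢false (trans (sym pi) (trans (chosen-connected c) ¬cj))
      no-edge : ¬ (3 ≤ gcd (at ds i) (at ds j))
      no-edge le with i ≟ j
      ... | yes refl = true≢false (trans (sym pi) ¬cj)
      ... | no i≢j = ¬connected (edge⇒connected (∧-true⁺ vi (∧-true⁺ vj (∧-true⁺ (not-true⁺ (eqb-false⁺ _≟_ i≢j)) (≤ᵇ-true⁺ le)))))

    solution = ±1-solution plusMods minusMods (mods≢0 plus) (mods≢0 (λ i → not (plus i))) plus-minus-gcd∣2

    c : ℕ
    c = proj₁ solution

    c-plus : ∀ {i} → i < q → plus i ≡ true → modN c (at ds i) ≡ modN 1 (at ds i)
    c-plus lt pi = proj₁ (proj₂ solution) _ (∈-mods⁺ plus lt pi)

    c-minus : ∀ {i} → i < q → plus i ≡ false → modN (c + 1) (at ds i) ≡ 0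
    c-minus lt pi = proj₂ (proj₂ solution) _ (∈-mods⁺ (λ i → not (plus i)) lt (not-true⁺ pi))

    b₀ : ℕ
    b₀ = c % L

    modN-b₀ : ∀ {i} → i < q → modN b₀ (at ds i) ≡ modN c (at ds i)
    modN-b₀ lt = modN-% _ L (d∣L _ (at-∈ ds lt)) c

    b₀-isUnit : isUnit b₀ ≡ true
    b₀-isUnit = isUnit-% {c} (gcd≡1-∣ {c} {N} {L} (gcd≡1-product {c} ds c-coprime) L∣N)
      where
      c-coprime : ∀ d → d ∈ ds → gcd c d ≡ 1
      c-coprime d dm with ∈⇒at ds dm
      ... | i , lt , refl with plus i in pi
      ... | true = ≡1⇒gcd≡1 (at ds i) c (at≢0 lt) (c-plus lt pi)
      ... | false = ≡-1⇒gcd≡1 (at ds i) c (at≢0 lt) (c-minus lt pi)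

    b₀-fixes : fixesAll ds b₀ ≡ true
    b₀-fixes = fixesAll⁺ ds b₀ ±1
      where
      ±1 : ∀ d → d ∈ ds → rep d (modN b₀ d) ≡ 1
      ±1 d dm with ∈⇒at ds dm
      ... | i , lt , refl rewrite modN-b₀ lt with vertex ds i in vi
      ... | false = <3⇒rep≡1 (at ds i) _ (¬vertex⇒<3 vi)
      ... | true with plus i in pi
      ...   | true = ≡1⇒rep≡1 (at ds i) c (vertex⇒3≤ vi) (c-plus lt pi)
      ...   | false = ≡-1⇒rep≡1 (at ds i) c (vertex⇒3≤ vi) (c-minus lt pi)

    sign-b₀ : ∀ {r} → leader r ≡ true → sign b₀ r ≡ atB σ r
    sign-b₀ {r} lr = trans (cong (λ t → eqb _≟_ t 1) (modN-b₀ lt)) (by-σ (atB σ r) refl)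
      where
      vr = leader⇒vertex lr
      lt = vertex⇒< vr
      plus≡σ : plus r ≡ atB σ r
      plus≡σ = trans (cong (λ t → not t ∨ chosen r) vr) (chosen-leader lr)
      by-σ : ∀ t → atB σ r ≡ t → eqb _≟_ (modN c (at ds r)) 1 ≡ atB σ r
      by-σ true e = trans (eqb-true⁺ _≟_ (trans (c-plus lt (trans plus≡σ e)) (modN-1 (at ds r) (vertex⇒3≤ vr)))) (sym e)
        where
        modN-1 : ∀ d → 3 ≤ d → modN 1 d ≡ 1
        modN-1 (suc zero) (s≤s ())
        modN-1 (suc (suc zero)) (s≤s (s≤s ()))
        modN-1 (suc (suc (suc k))) _ = refl
      by-σ false e = trans (eqb-false⁺ _≟_ (≡-1⇒≢1 (at ds r) c (vertex⇒3≤ vr) (c-minus lt (trans plus≡σ e)))) (sym e)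

    signPattern-b₀ : signPattern b₀ ≡ σ
    signPattern-b₀ = atB-ext q (signPattern b₀) σ (length-applyUpTo _ q) (proj₁ (memPattern⁻ leader q σ hσ)) entry
      where
      entry : ∀ i → i < q → atB (signPattern b₀) i ≡ atB σ i
      entry i lt with leader i in li
      ... | true = trans (atB-signPattern b₀ li) (sign-b₀ li)
      ... | false = trans (atB-applyUpTo _ q lt) (trans (cong (if_then sign b₀ i else true) li) (sym (proj₂ (memPattern⁻ leader q σ hσ) i li)))

  #fixes≡2^components : ∑ (λ b → 𝟙 (fixesAll ds b)) (units L) ≡ 2 ^ components ds
  #fixes≡2^components = begin
    ∑ (λ b → 𝟙 (fixesAll ds b)) (units L)   ≡⟨ count-by-bijection (patterns-enumerates leader q) (fixesAll ds) signPattern (units L)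
                                                   (λ b _ _ → memPattern-signPattern b) one-preimage ⟩
    length (patterns leader q)              ≡⟨ length-patterns leader q ⟩
    2 ^ ∑ (λ v → 𝟙 (leader v)) (upTo q)     ≡⟨ cong (2 ^_) (sym components≡#leaders) ⟩
    2 ^ components ds                       ∎
    where
    open ≡-Reasoning
    _≟ᴮ_ = ≡-dec Bool._≟_
    one-preimage : ∀ σ → σ ∈ patterns leader q → ∑ (λ b → 𝟙 (fixesAll ds b ∧ eqb _≟ᴮ_ (signPattern b) σ)) (units L) ≡ 1
    one-preimage σ σm = count-unique (units-enumerates L) _ b₀ b₀-isUnit (∧-true⁺ b₀-fixes (eqb-true⁺ _≟ᴮ_ signPattern-b₀)) unique
      where
      open Realise σ (sound (patterns-enumerates leader q) σm)
      unique : ∀ b → b ∈ units L → (fixesAll ds b ∧ eqb _≟ᴮ_ (signPattern b) σ) ≡ true → b ≡ b₀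
      unique b bm h with ∧-true⁻ {fixesAll ds b} h
      ... | fb , e = leader-signs-determine {b} {b₀} (sound (units-enumerates L) bm) b₀-isUnit fb b₀-fixes λ r lr →
        trans (sym (atB-signPattern b lr)) (trans (cong (λ τ → atB τ r) same-pattern) (atB-signPattern b₀ lr))
        where
        same-pattern : signPattern b ≡ signPattern b₀
        same-pattern = trans (eqb-true⁻ _≟ᴮ_ {signPattern b} {σ} e) (sym signPattern-b₀)

module OrbitFormula (ds : List ℕ) (pos : All (1 ≤_) ds) where
  open UnitAction ds pos using (L; L-nonZero; L≢0; d∣L; orb*|units|)
  open Graph ds
  open Stabiliser ds pos using (#fixes≡2^components)

  P : ℕ
  P = product (map φ̃ ds)

  orb*φ≡ : orb ds * φ L ≡ P * 2 ^ components ds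
  orb*φ≡ = begin
    orb ds * φ L                                                ≡⟨ cong (orb ds *_) (sym (length-units L)) ⟩
    orb ds * length (units L)                                   ≡⟨ orb*|units| ⟩
    length (tuples ds) * ∑ (λ b → 𝟙 (fixesAll ds b)) (units L)  ≡⟨ cong₂ _*_ (trans (length-tuples ds) (cong product (map-cong |J|≡φ̃ ds)))
                                                                              #fixes≡2^components ⟩
    P * 2 ^ components ds                                       ∎
    where open ≡-Reasoning

  -- Without vertices every dᵢ divides 2, hence so does L.
  no-components⇒φ≡φ̃ : components ds ≡ 0 → φ L ≡ φ̃ L
  no-components⇒φ≡φ̃ none = trans (proj₁ (φ≡φ̃≡1 1≤L L≤2)) (sym (proj₂ (φ≡φ̃≡1 1≤L L≤2)))
    where
    1≤L = n≢0⇒n>0 L≢0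
    ¬vertex : ∀ i → vertex ds i ≡ false
    ¬vertex i with vertex ds i in vi
    ... | false = refl
    ... | true with leader-exists vi
    ... | r , lr , cr = ⊥-elim (true≢false (trans (sym lr)
            (∑𝟙≡0⇒false leader (upTo q) (trans (sym components≡#leaders) none) r (∈-upTo⁺ (vertex⇒< (leader⇒vertex lr))))))
    L≤2 : L ≤ 2
    L≤2 = ∣⇒≤ (lcmList-least ds λ d dm → let i , _ , eq = ∈⇒at ds dm in
            subst (_∣ 2) eq (<3⇒∣2 (subst (1 ≤_) (sym eq) (All.lookup pos dm)) (¬vertex⇒<3 (¬vertex i))))

  some-component⇒φ≡2*φ̃ : ∀ {c} → components ds ≡ suc c → φ L ≡ 2 * φ̃ L
  some-component⇒φ≡2*φ̃ some
    with ∑≢0⇒∃≢0 (λ v → 𝟙 (leader v)) (upTo q) (λ z → 0≢1+n (trans (sym z) (trans (sym components≡#leaders) some)))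
  ... | r , rm , lr = φ≡2*φ̃ (≤-trans (vertex⇒3≤ vr) (∣⇒≤ (d∣L (at ds r) (at-∈ ds (vertex⇒< vr)))))
    where vr = leader⇒vertex (𝟙≢0⇒≡true lr)

  orbit-formula : orb ds * φ̃ L ≡ P * 2 ^ (components ds ∸ 1)
  orbit-formula with components ds in c
  ... | zero = begin
    orb ds * φ̃ L               ≡⟨ cong (orb ds *_) (sym (no-components⇒φ≡φ̃ c)) ⟩
    orb ds * φ L                ≡⟨ orb*φ≡ ⟩
    P * 2 ^ components ds       ≡⟨ cong (λ t → P * 2 ^ t) c ⟩
    P * 1                       ∎
    where open ≡-Reasoning
  ... | suc k = *-cancelˡ-≡ (orb ds * φ̃ L) (P * 2 ^ k) 2 (begin
    2 * (orb ds * φ̃ L)         ≡⟨ x∙yz≈y∙xz 2 (orb ds) (φ̃ L) ⟩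
    orb ds * (2 * φ̃ L)         ≡⟨ cong (orb ds *_) (sym (some-component⇒φ≡2*φ̃ c)) ⟩
    orb ds * φ L                ≡⟨ orb*φ≡ ⟩
    P * 2 ^ components ds       ≡⟨ cong (λ t → P * 2 ^ t) c ⟩
    P * (2 * 2 ^ k)             ≡⟨ x∙yz≈y∙xz P 2 (2 ^ k) ⟩
    2 * (P * 2 ^ k)             ∎)
    where open ≡-Reasoning

theorem1p4 : (q : ℕ) (d : Vec ℕ q) → VecAll.All (1 ≤_) d →
    orb (toList d) * φ̃ (lcmList (toList d))
      ≡ product (map φ̃ (toList d)) * 2 ^ β̃₀ (toList d)
theorem1p4 q d h = OrbitFormula.orbit-formula (toList d) (toList⁺ h)
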